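{- Let $G=(V,E)$ and $G'=(V',E')$ be finite simple graphs and $H=G\sqcup G'$ their disjoint union. Then $$T\chi^L_H(q)=\binom{|V|+|V'|}{|V|}\,T\chi^L_G(q)\,T\chi^L_{G'}(q).$$
   Context: For a finite simple graph $G=(V,E)$, a labeling is a bijection $L:V\to\{1,\dots,|V|\}$ and a proper coloring is a map $\kappa:V\to\mathbb{Z}_{>0}$ with $\kappa(u)\ne\kappa(v)$ whenever $\{u,v\}\in E$. $\mathrm{asc}^L(\kappa)$ is the number of edges $\{u,v\}\in E$ with $L(u)<L(v)$ and $\kappa(u)<\kappa(v)$. The chromatic quasisymmetric function is $\chi^L_G(x;q)=\sum_\kappa q^{\mathrm{asc}^L(\kappa)}x^\kappa$ (sum over proper colorings, $x^\kappa=\prod_j x_j^{\#\kappa^{ -1}(j)}$), and the total labeling chromatic quasisymmetric function is $T\chi^L_G(q)=\sum_L\chi^L_G(x;q)$, summed over all labelings $L$ of $G$. -}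

module Defs where

open import Data.Nat using (ℕ; zero; suc; _+_; _*_; _∸_; _≡ᵇ_; _<ᵇ_)
open import Data.Nat.Combinatorics using (_C_)
open import Data.Bool using (Bool; true; false; _∧_; _∨_; not; if_then_else_)
open import Data.Fin using (Fin; zero; suc; splitAt; toℕ)
open import Data.Fin.Properties using (_≟_)
open import Data.List using (List; []; _∷_; map; concatMap; upTo; allFin)
open import Data.Bool.ListAction using (all)
open import Data.Nat.ListAction using (sum)
open import Data.Vec using (Vec; []; _∷_; lookup)
open import Data.Product using (_×_; _,_)
open import Data.Sum using (inj₁; inj₂)
open import Relation.Nullary using (does)
open import Relation.Binary.PropositionalEquality using (_≡_; refl)

record SimpleGraph (n : ℕ) : Set where
  field
    adj        : Fin n → Fin n → Bool
    adj-sym    : ∀ u v → adj u v ≡ adj v u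
    adj-irrefl : ∀ u → adj u u ≡ false
open SimpleGraph public

⊔-adj : ∀ {n m} → SimpleGraph n → SimpleGraph m → Fin (n + m) → Fin (n + m) → Bool
⊔-adj {n} G G' u v with splitAt n u | splitAt n v
... | inj₁ a | inj₁ b = adj G a b
... | inj₂ a | inj₂ b = adj G' a b
... | inj₁ _ | inj₂ _ = false
... | inj₂ _ | inj₁ _ = false

⊔-sym : ∀ {n m} (G : SimpleGraph n) (G' : SimpleGraph m) u v → ⊔-adj G G' u v ≡ ⊔-adj G G' v u
⊔-sym {n} G G' u v with splitAt n u | splitAt n v
... | inj₁ a | inj₁ b = adj-sym G a b
... | inj₂ a | inj₂ b = adj-sym G' a b
... | inj₁ _ | inj₂ _ = refl
... | inj₂ _ | inj₁ _ = refl

⊔-irrefl : ∀ {n m} (G : SimpleGraph n) (G' : SimpleGraph m) u → ⊔-adj G G' u u ≡ false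
⊔-irrefl {n} G G' u with splitAt n u
... | inj₁ a = adj-irrefl G a
... | inj₂ a = adj-irrefl G' a

_⊔_ : ∀ {n m} → SimpleGraph n → SimpleGraph m → SimpleGraph (n + m)
G ⊔ G' = record { adj = ⊔-adj G G' ; adj-sym = ⊔-sym G G' ; adj-irrefl = ⊔-irrefl G G' }

allFuns : ∀ n k → List (Fin n → Fin k)
allFuns zero    k = (λ ()) ∷ []
allFuns (suc n) k = concatMap (λ f → map (λ c → cons c f) (allFin k)) (allFuns n k)
  where
  cons : Fin k → (Fin n → Fin k) → Fin (suc n) → Fin k
  cons c f zero    = c
  cons c f (suc i) = f i

_==_ : ∀ {k} → Fin k → Fin k → Bool
a == b = does (a ≟ b)

countB : ∀ {n} → (Fin n → Bool) → ℕ
countB {n} p = sum (map (λ u → if p u then 1 else 0) (allFin n))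

allB : ∀ {n} → (Fin n → Bool) → Bool
allB {n} p = all p (allFin n)

-- L : Fin n → Fin n is a labeling iff it is a bijection (equivalently injective
-- on a finite set); label of u is toℕ (L u) + 1.
isLabeling : ∀ {n} → (Fin n → Fin n) → Bool
isLabeling L = allB (λ u → allB (λ v → not (L u == L v) ∨ (u == v)))

-- colorings with colors in {1,…,k} (color c : Fin k stands for toℕ c + 1)
isProper : ∀ {n k} → SimpleGraph n → (Fin n → Fin k) → Bool
isProper G κ = allB (λ u → allB (λ v → not (adj G u v) ∨ not (κ u == κ v)))

-- asc^L(κ): edges {u,v} with L(u) < L(v) and κ(u) < κ(v); counted as ordered
-- pairs (u,v) with L u < L v, which picks each unordered edge at most once.
asc : ∀ {n k} → SimpleGraph n → (Fin n → Fin n) → (Fin n → Fin k) → ℕ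
asc G L κ = sum (map (λ u → countB (λ v →
  adj G u v ∧ (toℕ (L u) <ᵇ toℕ (L v)) ∧ (toℕ (κ u) <ᵇ toℕ (κ v)))) (allFin _))

-- x^κ = x^α where α c = #κ⁻¹(c)
hasContent : ∀ {n k} → (Fin n → Fin k) → Vec ℕ k → Bool
hasContent {n} {k} κ α = allB (λ c → countB (λ u → κ u == c) ≡ᵇ lookup α c)

-- Formal power series in q, x₁, x₂, … with ℕ coefficients, given by their
-- coefficient functions: coefficient of q^j x₁^{α₁}⋯x_k^{α_k} for α : Vec ℕ k.
-- (Every monomial involves finitely many variables.)

Series : Set
Series = (k : ℕ) → Vec ℕ k → ℕ → ℕ

-- Tχ_G(q) = Σ_L χ^L_G(x;q): the coefficient of q^j x^α counts pairs (L, κ)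
-- with L a labeling, κ a proper coloring of content α, asc^L(κ) = j.
Tχ : ∀ {n} → SimpleGraph n → Series
Tχ {n} G k α j =
  sum (map (λ L → sum (map (λ κ →
      if isLabeling L ∧ isProper G κ ∧ hasContent κ α ∧ (asc G L κ ≡ᵇ j)
      then 1 else 0) (allFuns n k))) (allFuns n n))

splits : ∀ {k} → Vec ℕ k → List (Vec ℕ k × Vec ℕ k)
splits [] = ([] , []) ∷ []
splits (a ∷ α) = concatMap (λ i → map (λ { (β , γ) → (i ∷ β , (a ∸ i) ∷ γ) }) (splits α)) (upTo (suc a))

_⊛_ : Series → Series → Series
(A ⊛ B) k α j = sum (map (λ { (β , γ) → sum (map (λ i → A k β i * B k γ (j ∸ i)) (upTo (suc j))) }) (splits α))

_·ˢ_ : ℕ → Series → Series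
(c ·ˢ A) k α j = c * A k α j

-- Write Tχ_H as a sum over colorings κ of H of [κ proper] · x^κ · #{labelings L with asc^L(κ) = i}.
-- A coloring of G ⊔ G′ is a pair (κ₁, κ₂) of colorings of G and G′; it is proper iff both are, its
-- content is the sum of theirs, and asc^L(κ₁ ++ κ₂) = asc^{L₁}(κ₁) + asc^{L₂}(κ₂), where L₁ and L₂ are
-- the restrictions of L to G and G′. Ascents only see the relative order of labels, so L₁ and L₂ may be
-- replaced by their standardizations. A labeling of G ⊔ G′ is determined by the set of labels it gives
-- to G together with these two standardizations, and every n-subset of the labels and every pair of
-- labelings of G and G′ arises; this yields the factor C(n + m, n), and what remains factors as the
-- Cauchy product Tχ_G ⊛ Tχ_G′.

module Submission where

open import Defs
open import Data.Nat using (ℕ; _+_)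
open import Data.Nat.Combinatorics using (_C_)
open import Data.Vec using (Vec)
open import Relation.Binary.PropositionalEquality using (_≡_)

open import Data.Bool using (Bool; true; false; _∧_; _∨_; not; if_then_else_)
open import Data.Bool.ListAction using (and)
open import Data.Bool.Properties using (∧-assoc; ∧-identityʳ; ∨-zeroʳ; T-≡; ⇔→≡)
open import Data.Fin using (Fin; zero; suc; toℕ; fromℕ<; _↑ˡ_; _↑ʳ_; punchIn; splitAt)
open import Data.Fin.Properties
  using ( _≟_; 0≢1+n; suc-injective; toℕ-fromℕ<; toℕ-injective; ↑ˡ-injective; ↑ʳ-injective
        ; splitAt-↑ˡ; splitAt-↑ʳ; splitAt⁻¹-↑ˡ; splitAt⁻¹-↑ʳ )
open import Data.List as List using (List; []; _∷_; map; concatMap; tabulate; allFin; cartesianProduct; upTo)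
open import Data.List.Properties using (map-cong; map-++; map-tabulate; upTo-∷ʳ)
open import Data.List.Relation.Unary.All.Properties using (all⁺; all⁻; tabulate⁺; tabulate⁻)
open import Data.Nat using (zero; suc; _*_; _∸_; _!; _≤_; _<_; z≤n; s≤s; _≡ᵇ_; _<ᵇ_; >-nonZero)
open import Data.Nat.Combinatorics using (nCk+nC[k+1]≡[n+1]C[k+1]; nCk≡n!/k![n-k]!; k![n∸k]!∣n!)
open import Data.Nat.Combinatorics.Base using (_P′_)
open import Data.Nat.Combinatorics.Specification using (nP′n≡n!)
open import Data.Nat.DivMod using (_/_; m/n*n≡m)
open import Data.Nat.ListAction using (sum)
open import Data.Nat.ListAction.Properties using (sum-++)
open import Data.Nat.Properties
  using ( +-*-semiring; +-commutativeSemigroup; *-commutativeSemigroup; _<?_; _≤?_; <-cmp; _!*_!≢0; module ≤-Reasoning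
        ; +-assoc; +-comm; +-identityʳ; +-cancelˡ-≡; +-cancelʳ-≤; +-mono-≤; +-monoʳ-≤; +-mono-<-≤
        ; *-assoc; *-identityˡ; *-identityʳ; *-zeroʳ; *-distribˡ-+; *-distribʳ-+; *-monoʳ-≤; *-monoʳ-<
        ; ≤-refl; ≤-reflexive; ≤-trans; ≤-antisym; ≤-pred; <-irrefl; <-≤-trans
        ; <⇒≤; <⇒≢; <⇒≯; ≤⇒≯; ≮⇒≥; n≮n; n<1+n
        ; m≤m+n; m<n⇒m<1+n; m+n∸m≡n; m+n∸n≡m; m+[n∸m]≡n )
  renaming (_≟_ to _≟ℕ_)
open import Algebra.Properties.CommutativeSemigroup +-commutativeSemigroup using () renaming (interchange to +-interchange)
open import Algebra.Properties.CommutativeSemigroup *-commutativeSemigroup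
  using () renaming (interchange to *-interchange; x∙yz≈y∙xz to x*[y*z]≡y*[x*z])
open import Algebra.Properties.Semiring.Sum +-*-semiring
  using (sum-syntax; sum-cong-≗; sum-replicate-zero; sum-remove; ∑-distrib-+; ∑-comm; *-distribʳ-sum)
open import Data.Nat.Tactic.RingSolver using (solve-∀)
open import Data.Product using (_×_; _,_; ∃; proj₁; proj₂)
open import Data.Sum using (_⊎_; inj₁; inj₂)
open import Data.Vec using ([]; _∷_; lookup)
open import Data.Vec.Functional using (_++_) renaming (_∷_ to _∷ᵥ_)
open import Data.Vec.Functional.Properties using (++-cong; lookup-++ˡ; lookup-++ʳ)
open import Function using (_∘_; id)
open import Function.Bundles using (Equivalence; mk⇔)
open import Function.Definitions using (Injective)
open import Relation.Binary.Definitions using (tri<; tri≈; tri>)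
open import Relation.Binary.PropositionalEquality using (refl; sym; trans; cong; cong₂; subst; subst₂; _≢_; _≗_; module ≡-Reasoning)
open import Relation.Nullary using (Dec; yes; no; does; ¬_; contradiction)
open import Relation.Nullary.Decidable using (dec-true; dec-false; does-⇔)

⟦_⟧ : Bool → ℕ
⟦ b ⟧ = if b then 1 else 0

⟦∧⟧ : ∀ a b → ⟦ a ∧ b ⟧ ≡ ⟦ a ⟧ * ⟦ b ⟧
⟦∧⟧ true  b = sym (+-identityʳ ⟦ b ⟧)
⟦∧⟧ false b = refl

⟦∧∧⟧-* : ∀ a b c w → ⟦ a ∧ b ∧ c ⟧ * w ≡ ⟦ a ⟧ * (⟦ b ⟧ * (⟦ c ⟧ * w))
⟦∧∧⟧-* true  b c w = trans (cong (_* w) (⟦∧⟧ b c)) (trans (*-assoc ⟦ b ⟧ ⟦ c ⟧ w) (sym (*-identityˡ _)))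
⟦∧∧⟧-* false b c w = refl

⟦⟧≤1 : ∀ b → ⟦ b ⟧ ≤ 1
⟦⟧≤1 true  = ≤-refl
⟦⟧≤1 false = z≤n

∧-true : ∀ {a b} → (a ∧ b) ≡ true → a ≡ true × b ≡ true
∧-true {true} {true} _ = refl , refl

does-true : ∀ {P : Set} (d : Dec P) → does d ≡ true → P
does-true (yes p) _ = p

-- The deciders _<?_ and _≟_ on ℕ are implemented by _<ᵇ_ and _≡ᵇ_, so their does computes to these tests.
<ᵇ-true : ∀ {a b} → a < b → (a <ᵇ b) ≡ true
<ᵇ-true {a} {b} = dec-true (a <? b)

<ᵇ-false : ∀ {a b} → ¬ a < b → (a <ᵇ b) ≡ false
<ᵇ-false {a} {b} = dec-false (a <? b)

≡ᵇ-true : ∀ {a b} → a ≡ b → (a ≡ᵇ b) ≡ true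
≡ᵇ-true {a} {b} = dec-true (a ≟ℕ b)

≡ᵇ-false : ∀ {a b} → a ≢ b → (a ≡ᵇ b) ≡ false
≡ᵇ-false {a} {b} = dec-false (a ≟ℕ b)

private variable
  A B : Set

sumMap : List A → (A → ℕ) → ℕ
sumMap xs f = sum (map f xs)

infixl 10 sumMap
syntax sumMap xs (λ x → e) = ∑[ x ← xs ] e

sumMap-zero : ∀ (xs : List A) {f : A → ℕ} → f ≗ (λ _ → 0) → sumMap xs f ≡ 0
sumMap-zero []       f≗0 = refl
sumMap-zero (x ∷ xs) f≗0 = cong₂ _+_ (f≗0 x) (sumMap-zero xs f≗0)

sumMap-cong : ∀ (xs : List A) {f g : A → ℕ} → f ≗ g → sumMap xs f ≡ sumMap xs g
sumMap-cong xs f≗g = cong sum (map-cong f≗g xs)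

sumMap-distrib-+ : ∀ (xs : List A) (f g : A → ℕ) →
  ∑[ x ← xs ] (f x + g x) ≡ sumMap xs f + sumMap xs g
sumMap-distrib-+ []       f g = refl
sumMap-distrib-+ (x ∷ xs) f g =
  trans (cong (f x + g x +_) (sumMap-distrib-+ xs f g)) (+-interchange (f x) (g x) _ _)

sumMap-*ˡ : ∀ (xs : List A) c (f : A → ℕ) → c * sumMap xs f ≡ ∑[ x ← xs ] (c * f x)
sumMap-*ˡ []       c f = *-zeroʳ c
sumMap-*ˡ (x ∷ xs) c f = trans (*-distribˡ-+ c (f x) _) (cong (c * f x +_) (sumMap-*ˡ xs c f))

sumMap-*ʳ : ∀ (xs : List A) c (f : A → ℕ) → sumMap xs f * c ≡ ∑[ x ← xs ] (f x * c)
sumMap-*ʳ []       c f = refl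
sumMap-*ʳ (x ∷ xs) c f = trans (*-distribʳ-+ c (f x) _) (cong (f x * c +_) (sumMap-*ʳ xs c f))

sumMap-++ : ∀ (xs ys : List A) (f : A → ℕ) → sumMap (xs List.++ ys) f ≡ sumMap xs f + sumMap ys f
sumMap-++ xs ys f = trans (cong sum (map-++ f xs ys)) (sum-++ (map f xs) (map f ys))

sumMap-comm : ∀ (xs : List A) (ys : List B) (f : A → B → ℕ) →
  ∑[ x ← xs ] ∑[ y ← ys ] f x y ≡ ∑[ y ← ys ] ∑[ x ← xs ] f x y
sumMap-comm []       ys f = sym (sumMap-zero ys (λ _ → refl))
sumMap-comm (x ∷ xs) ys f =
  trans (cong (sumMap ys (f x) +_) (sumMap-comm xs ys f)) (sym (sumMap-distrib-+ ys (f x) _))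

sumMap-concatMap : ∀ (g : A → List B) (xs : List A) (f : B → ℕ) →
  sumMap (concatMap g xs) f ≡ ∑[ x ← xs ] sumMap (g x) f
sumMap-concatMap g []       f = refl
sumMap-concatMap g (x ∷ xs) f =
  trans (sumMap-++ (g x) (concatMap g xs) f) (cong (sumMap (g x) f +_) (sumMap-concatMap g xs f))

sumMap-map : ∀ (g : A → B) (xs : List A) (f : B → ℕ) → sumMap (map g xs) f ≡ ∑[ x ← xs ] f (g x)
sumMap-map g []       f = refl
sumMap-map g (x ∷ xs) f = cong (f (g x) +_) (sumMap-map g xs f)

sumMap-tabulate : ∀ {n} (g : Fin n → A) (f : A → ℕ) → sumMap (tabulate g) f ≡ ∑[ i < n ] f (g i)
sumMap-tabulate {n = zero}  g f = refl
sumMap-tabulate {n = suc n} g f = cong (f (g zero) +_) (sumMap-tabulate (g ∘ suc) f)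

sumMap-mono-≤ : ∀ (xs : List A) {f g : A → ℕ} → (∀ x → f x ≤ g x) → sumMap xs f ≤ sumMap xs g
sumMap-mono-≤ []       f≤g = z≤n
sumMap-mono-≤ (x ∷ xs) f≤g = +-mono-≤ (f≤g x) (sumMap-mono-≤ xs f≤g)

sumMap-squeeze : ∀ (xs : List A) {f g : A → ℕ} (w : A → ℕ) → (∀ x → f x ≤ g x) →
  sumMap xs f ≡ sumMap xs g → ∑[ x ← xs ] (f x * w x) ≡ ∑[ x ← xs ] (g x * w x)
sumMap-squeeze []       w f≤g eq = refl
sumMap-squeeze (x ∷ xs) {f} {g} w f≤g eq =
  cong₂ _+_ (cong (_* w x) fx≡gx) (sumMap-squeeze xs w f≤g (+-cancelˡ-≡ (f x) _ _ rest))
  where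
  fx≡gx : f x ≡ g x
  fx≡gx = ≤-antisym (f≤g x) (+-cancelʳ-≤ _ _ _ (≤-trans (≤-reflexive (sym eq)) (+-monoʳ-≤ (f x) (sumMap-mono-≤ xs f≤g))))
  rest : f x + sumMap xs f ≡ f x + sumMap xs g
  rest = trans eq (cong (_+ sumMap xs g) (sym fx≡gx))

sumMap-witness : ∀ (xs : List A) (p : A → Bool) → ∑[ x ← xs ] ⟦ p x ⟧ ≡ 0 ⊎ ∃ λ x → p x ≡ true
sumMap-witness []       p = inj₁ refl
sumMap-witness (x ∷ xs) p with p x in px
... | true  = inj₂ (x , px)
... | false = sumMap-witness xs p

sumMap-at-most-one : ∀ (xs : List A) (p : A → Bool) (δ : A → A → ℕ) → (∀ x → sumMap xs (δ x) ≡ 1) →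
  (∀ x y → p x ≡ true → ⟦ p y ⟧ ≤ δ x y) → ∑[ y ← xs ] ⟦ p y ⟧ ≤ 1
sumMap-at-most-one xs p δ mass-1 p⇒δ with sumMap-witness xs p
... | inj₁ none       = ≤-trans (≤-reflexive none) z≤n
... | inj₂ (x , px)   = ≤-trans (sumMap-mono-≤ xs λ y → p⇒δ x y px) (≤-reflexive (mass-1 x))

sumMap-allFin : ∀ {n} (f : Fin n → ℕ) → sumMap (allFin n) f ≡ ∑[ i < n ] f i
sumMap-allFin = sumMap-tabulate id

sumMap-cartesianProduct : ∀ (xs : List A) (ys : List B) (F : A × B → ℕ) →
  sumMap (cartesianProduct xs ys) F ≡ ∑[ x ← xs ] ∑[ y ← ys ] F (x , y)
sumMap-cartesianProduct []       ys F = refl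
sumMap-cartesianProduct (x ∷ xs) ys F = trans (sumMap-++ (map (x ,_) ys) _ F)
  (cong₂ _+_ (sumMap-map (x ,_) ys F) (sumMap-cartesianProduct xs ys F))

sumMap-product : ∀ (xs : List A) (ys : List B) (f : A → ℕ) (g : B → ℕ) →
  ∑[ x ← xs ] ∑[ y ← ys ] (f x * g y) ≡ sumMap xs f * sumMap ys g
sumMap-product xs ys f g = trans (sumMap-cong xs (λ x → sym (sumMap-*ˡ ys (f x) g))) (sym (sumMap-*ʳ xs (sumMap ys g) f))

sumMap₂-*ˡ : ∀ (xs : List A) (ys : List B) c (f : A → B → ℕ) →
  c * ∑[ x ← xs ] ∑[ y ← ys ] f x y ≡ ∑[ x ← xs ] ∑[ y ← ys ] (c * f x y)
sumMap₂-*ˡ xs ys c f = trans (sumMap-*ˡ xs c _) (sumMap-cong xs λ x → sumMap-*ˡ ys c (f x))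

sumMap-map-allFin : ∀ {n} (g : Fin n → A) (f : A → ℕ) → sumMap (map g (allFin n)) f ≡ ∑[ i < n ] f (g i)
sumMap-map-allFin g f = trans (sumMap-map g (allFin _) f) (sumMap-tabulate id (f ∘ g))

∑-const-1 : ∀ n → ∑[ i < n ] 1 ≡ n
∑-const-1 zero    = refl
∑-const-1 (suc n) = cong suc (∑-const-1 n)

∑-++ : ∀ n {m} (f : Fin (n + m) → ℕ) → ∑[ u < n + m ] f u ≡ ∑[ a < n ] f (a ↑ˡ m) + ∑[ b < m ] f (n ↑ʳ b)
∑-++ zero    f = refl
∑-++ (suc n) f = trans (cong (f zero +_) (∑-++ n (f ∘ suc))) (sym (+-assoc (f zero) _ _))

∑-mono-≤ : ∀ {n} {f g : Fin n → ℕ} → (∀ i → f i ≤ g i) → ∑[ i < n ] f i ≤ ∑[ i < n ] g i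
∑-mono-≤ {zero}  f≤g = z≤n
∑-mono-≤ {suc n} f≤g = +-mono-≤ (f≤g zero) (∑-mono-≤ (f≤g ∘ suc))

∑-mono-< : ∀ {n} {f g : Fin n → ℕ} (a : Fin n) → (∀ i → f i ≤ g i) → f a < g a → ∑[ i < n ] f i < ∑[ i < n ] g i
∑-mono-< {suc n} {f} {g} a f≤g fa<ga = subst₂ _<_ (sym (sum-remove {i = a} f)) (sym (sum-remove {i = a} g))
  (+-mono-<-≤ fa<ga (∑-mono-≤ (f≤g ∘ punchIn a)))

∑-zero : ∀ {n} {f : Fin n → ℕ} → f ≗ (λ _ → 0) → ∑[ i < n ] f i ≡ 0
∑-zero {n} f≗0 = trans (sum-cong-≗ f≗0) (sum-replicate-zero n)

∑-term-≤ : ∀ {n} (f : Fin n → ℕ) a → f a ≤ ∑[ i < n ] f i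
∑-term-≤ {suc n} f a = ≤-trans (m≤m+n (f a) _) (≤-reflexive (sym (sum-remove {i = a} f)))

∑-squeeze : ∀ {n} {f g : Fin n → ℕ} → (∀ i → f i ≤ g i) → ∑[ i < n ] f i ≡ ∑[ i < n ] g i → f ≗ g
∑-squeeze f≤g eq a = ≤-antisym (f≤g a) (≮⇒≥ λ fa<ga → <-irrefl eq (∑-mono-< a f≤g fa<ga))

∑-delta : ∀ {n} (a : Fin n) (h : Fin n → ℕ) → ∑[ y < n ] (⟦ a == y ⟧ * h y) ≡ h a
∑-delta {suc n} zero    h = trans (cong (h zero + 0 +_) (sum-replicate-zero n)) (trans (+-identityʳ _) (+-identityʳ _))
∑-delta {suc n} (suc a) h = ∑-delta a (h ∘ suc)

∑-indicator : ∀ {n} (a : Fin n) → ∑[ y < n ] ⟦ a == y ⟧ ≡ 1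
∑-indicator a = trans (sum-cong-≗ λ y → sym (*-identityʳ ⟦ a == y ⟧)) (∑-delta a (λ _ → 1))

∑-sumMap-comm : ∀ {n} (xs : List A) (f : Fin n → A → ℕ) →
  ∑[ i < n ] ∑[ x ← xs ] f i x ≡ ∑[ x ← xs ] ∑[ i < n ] f i x
∑-sumMap-comm {n = n} xs f = begin
  ∑[ i < n ] sumMap xs (f i)                ≡⟨ sumMap-allFin (λ i → sumMap xs (f i)) ⟨
  ∑[ i ← allFin n ] sumMap xs (f i)         ≡⟨ sumMap-comm (allFin n) xs f ⟩
  ∑[ x ← xs ] ∑[ i ← allFin n ] f i x       ≡⟨ sumMap-cong xs (λ x → sumMap-allFin (λ i → f i x)) ⟩
  ∑[ x ← xs ] ∑[ i < n ] f i x              ∎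
  where open ≡-Reasoning

allB-suc : ∀ {n} (p : Fin (suc n) → Bool) → allB p ≡ p zero ∧ allB (p ∘ suc)
allB-suc p = cong (λ bs → p zero ∧ and bs) (trans (map-tabulate suc p) (sym (map-tabulate id (p ∘ suc))))

allB-cong : ∀ {n} {p q : Fin n → Bool} → p ≗ q → allB p ≡ allB q
allB-cong {n} p≗q = cong and (map-cong p≗q (allFin n))

allB-elim : ∀ {n} (p : Fin n → Bool) → allB p ≡ true → ∀ i → p i ≡ true
allB-elim p eq i = Equivalence.to T-≡ (tabulate⁻ (all⁺ p (allFin _) (Equivalence.from T-≡ eq)) i)

allB-intro : ∀ {n} (p : Fin n → Bool) → (∀ i → p i ≡ true) → allB p ≡ true
allB-intro p p≡true = Equivalence.to T-≡ (all⁻ p (tabulate⁺ (λ i → Equivalence.from T-≡ (p≡true i))))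

allB-++ : ∀ n {m} (p : Fin (n + m) → Bool) → allB p ≡ allB (p ∘ (_↑ˡ m)) ∧ allB (p ∘ (n ↑ʳ_))
allB-++ zero        p = refl
allB-++ (suc n) {m} p = begin
  allB p                                                          ≡⟨ allB-suc p ⟩
  p zero ∧ allB (p ∘ suc)                                         ≡⟨ cong (p zero ∧_) (allB-++ n (p ∘ suc)) ⟩
  p zero ∧ (allB (p ∘ suc ∘ (_↑ˡ m)) ∧ allB (p ∘ suc ∘ (n ↑ʳ_)))  ≡⟨ ∧-assoc (p zero) _ _ ⟨
  (p zero ∧ allB (p ∘ suc ∘ (_↑ˡ m))) ∧ allB (p ∘ suc ∘ (n ↑ʳ_))  ≡⟨ cong (_∧ allB (p ∘ (suc n ↑ʳ_))) (allB-suc (p ∘ (_↑ˡ m))) ⟨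
  allB (p ∘ (_↑ˡ m)) ∧ allB (p ∘ (suc n ↑ʳ_))                     ∎
  where open ≡-Reasoning

-- Without function extensionality, a sum over allFuns can only be reindexed when the summand respects
-- pointwise equality of its argument.
Extensional : ∀ {n k} → ((Fin n → Fin k) → ℕ) → Set
Extensional F = ∀ {f g} → f ≗ g → F f ≡ F g

labelings : ∀ n → List (Fin n → Fin n)
labelings n = allFuns n n

-- A subset of Fin n is given by its indicator function.
subsets : ∀ n → List (Fin n → Fin 2)
subsets n = allFuns n 2

allFuns-suc : ∀ n k (F : (Fin (suc n) → Fin k) → ℕ) → Extensional F →
  sumMap (allFuns (suc n) k) F ≡ ∑[ f ← allFuns n k ] ∑[ c < k ] F (c ∷ᵥ f)
allFuns-suc n k F F-ext = trans (sumMap-concatMap _ (allFuns n k) F) (sumMap-cong (allFuns n k) λ f →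
  trans (sumMap-map-allFin {n = k} _ F)
        (sum-cong-≗ λ c → F-ext {g = c ∷ᵥ f} λ { zero → refl ; (suc i) → refl }))

∷ᵥ-++ : ∀ {n m k} (c : Fin k) (f : Fin n → Fin k) (g : Fin m → Fin k) → (c ∷ᵥ f) ++ g ≗ c ∷ᵥ (f ++ g)
∷ᵥ-++ c f g zero = refl
∷ᵥ-++ {n} c f g (suc i) with splitAt n i
... | inj₁ a = refl
... | inj₂ b = refl

allFuns-++ : ∀ n m k (F : (Fin (n + m) → Fin k) → ℕ) → Extensional F →
  sumMap (allFuns (n + m) k) F ≡ ∑[ f ← allFuns n k ] ∑[ g ← allFuns m k ] F (f ++ g)
allFuns-++ zero    m k F F-ext = sym (+-identityʳ _)
allFuns-++ (suc n) m k F F-ext = begin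
  sumMap (allFuns (suc n + m) k) F
    ≡⟨ allFuns-suc (n + m) k F F-ext ⟩
  ∑[ h ← allFuns (n + m) k ] ∑[ c < k ] F (c ∷ᵥ h)
    ≡⟨ allFuns-++ n m k _ (λ h≗h′ → sum-cong-≗ λ c → F-ext (∷ᵥ-cong c h≗h′)) ⟩
  ∑[ f ← allFuns n k ] ∑[ g ← allFuns m k ] ∑[ c < k ] F (c ∷ᵥ (f ++ g))
    ≡⟨ sumMap-cong (allFuns n k) (λ f → sumMap-cong (allFuns m k) λ g → sum-cong-≗ λ c → F-ext (∷ᵥ-++ c f g)) ⟨
  ∑[ f ← allFuns n k ] ∑[ g ← allFuns m k ] ∑[ c < k ] F ((c ∷ᵥ f) ++ g)
    ≡⟨ sumMap-cong (allFuns n k) (λ f → ∑-sumMap-comm (allFuns m k) λ c g → F ((c ∷ᵥ f) ++ g)) ⟨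
  ∑[ f ← allFuns n k ] ∑[ c < k ] ∑[ g ← allFuns m k ] F ((c ∷ᵥ f) ++ g)
    ≡⟨ allFuns-suc n k _ (λ f≗f′ → sumMap-cong (allFuns m k) λ g → F-ext (++-cong _ _ f≗f′ λ _ → refl)) ⟨
  ∑[ f ← allFuns (suc n) k ] ∑[ g ← allFuns m k ] F (f ++ g)
    ∎
  where
  open ≡-Reasoning
  ∷ᵥ-cong : ∀ {j} c {h h′ : Fin j → Fin k} → h ≗ h′ → c ∷ᵥ h ≗ c ∷ᵥ h′
  ∷ᵥ-cong c h≗h′ zero    = refl
  ∷ᵥ-cong c h≗h′ (suc i) = h≗h′ i

≗-++ : ∀ {n m} {f g : Fin (n + m) → A} → f ∘ (_↑ˡ m) ≗ g ∘ (_↑ˡ m) → f ∘ (n ↑ʳ_) ≗ g ∘ (n ↑ʳ_) → f ≗ g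
≗-++ {n = n} {m = m} {f = f} {g} left right x with splitAt n x in eq
... | inj₁ a = subst (λ y → f y ≡ g y) (splitAt⁻¹-↑ˡ eq) (left a)
... | inj₂ b = subst (λ y → f y ≡ g y) (splitAt⁻¹-↑ʳ eq) (right b)

infix 4 _≗ᵇ_
_≗ᵇ_ : ∀ {n k} → (Fin n → Fin k) → (Fin n → Fin k) → Bool
f ≗ᵇ g = allB (λ i → f i == g i)

≗ᵇ⇒≗ : ∀ {n k} {f g : Fin n → Fin k} → (f ≗ᵇ g) ≡ true → f ≗ g
≗ᵇ⇒≗ {f = f} {g} eq i = does-true (f i ≟ g i) (allB-elim _ eq i)

≗⇒≗ᵇ : ∀ {n k} {f g : Fin n → Fin k} → f ≗ g → (f ≗ᵇ g) ≡ true
≗⇒≗ᵇ {f = f} {g} f≗g = allB-intro _ λ i → dec-true (f i ≟ g i) (f≗g i)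

allFuns-delta : ∀ n k (s : Fin n → Fin k) (w : (Fin n → Fin k) → ℕ) → Extensional w →
  ∑[ f ← allFuns n k ] (⟦ s ≗ᵇ f ⟧ * w f) ≡ w s
allFuns-delta zero    k s w w-ext = trans (+-identityʳ _) (trans (+-identityʳ _) (w-ext λ ()))
allFuns-delta (suc n) k s w w-ext = begin
  ∑[ f ← allFuns (suc n) k ] (⟦ s ≗ᵇ f ⟧ * w f)
    ≡⟨ allFuns-suc n k _ (λ f≗g → cong₂ _*_ (cong ⟦_⟧ (allB-cong λ i → cong (s i ==_) (f≗g i))) (w-ext f≗g)) ⟩
  ∑[ f ← allFuns n k ] ∑[ c < k ] (⟦ s ≗ᵇ c ∷ᵥ f ⟧ * w (c ∷ᵥ f))
    ≡⟨ sumMap-cong (allFuns n k) (λ f → sum-cong-≗ λ c → split-head f c) ⟩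
  ∑[ f ← allFuns n k ] ∑[ c < k ] (⟦ s zero == c ⟧ * (⟦ (s ∘ suc) ≗ᵇ f ⟧ * w (c ∷ᵥ f)))
    ≡⟨ sumMap-cong (allFuns n k) (λ f → ∑-delta (s zero) λ c → ⟦ (s ∘ suc) ≗ᵇ f ⟧ * w (c ∷ᵥ f)) ⟩
  ∑[ f ← allFuns n k ] (⟦ (s ∘ suc) ≗ᵇ f ⟧ * w (s zero ∷ᵥ f))
    ≡⟨ allFuns-delta n k (s ∘ suc) (λ f → w (s zero ∷ᵥ f)) (λ f≗g → w-ext λ { zero → refl ; (suc i) → f≗g i }) ⟩
  w (s zero ∷ᵥ s ∘ suc)
    ≡⟨ w-ext (λ { zero → refl ; (suc i) → refl }) ⟩
  w s
    ∎
  where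
  open ≡-Reasoning
  split-head : ∀ f c → ⟦ s ≗ᵇ c ∷ᵥ f ⟧ * w (c ∷ᵥ f) ≡ ⟦ s zero == c ⟧ * (⟦ (s ∘ suc) ≗ᵇ f ⟧ * w (c ∷ᵥ f))
  split-head f c = begin
    ⟦ s ≗ᵇ c ∷ᵥ f ⟧ * w (c ∷ᵥ f)
      ≡⟨ cong (λ b → ⟦ b ⟧ * w (c ∷ᵥ f)) (allB-suc (λ i → s i == (c ∷ᵥ f) i)) ⟩
    ⟦ (s zero == c) ∧ ((s ∘ suc) ≗ᵇ f) ⟧ * w (c ∷ᵥ f)
      ≡⟨ cong (_* w (c ∷ᵥ f)) (⟦∧⟧ (s zero == c) _) ⟩
    ⟦ s zero == c ⟧ * ⟦ (s ∘ suc) ≗ᵇ f ⟧ * w (c ∷ᵥ f)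
      ≡⟨ *-assoc ⟦ s zero == c ⟧ _ _ ⟩
    ⟦ s zero == c ⟧ * (⟦ (s ∘ suc) ≗ᵇ f ⟧ * w (c ∷ᵥ f))
      ∎

-- Injective maps and their images

isInjective : ∀ {n M} → (Fin n → Fin M) → Bool
isInjective f = allB (λ u → allB (λ v → not (f u == f v) ∨ (u == v)))

isInjective⇒injective : ∀ {n M} (f : Fin n → Fin M) → isInjective f ≡ true → Injective _≡_ _≡_ f
isInjective⇒injective f inj {u} {v} fu≡fv = does-true (u ≟ v)
  (subst (λ b → (not b ∨ (u == v)) ≡ true) (dec-true (f u ≟ f v) fu≡fv) (allB-elim _ (allB-elim _ inj u) v))

injective⇒isInjective : ∀ {n M} (f : Fin n → Fin M) → Injective _≡_ _≡_ f → isInjective f ≡ true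
injective⇒isInjective f inj = allB-intro _ λ u → allB-intro _ λ v → injective-at u v
  where
  injective-at : ∀ u v → (not (f u == f v) ∨ (u == v)) ≡ true
  injective-at u v with u ≟ v | f u ≟ f v
  ... | yes _   | _          = ∨-zeroʳ _
  ... | no _    | no _       = refl
  ... | no u≢v  | yes fu≡fv  = contradiction (inj fu≡fv) u≢v

isInjective-cong : ∀ {n M} {f g : Fin n → Fin M} → f ≗ g → isInjective f ≡ isInjective g
isInjective-cong f≗g = allB-cong λ u → allB-cong λ v → cong (λ b → not b ∨ _) (cong₂ _==_ (f≗g u) (f≗g v))

preimages : ∀ {n M} → (Fin n → Fin M) → Fin M → ℕ
preimages {n} f y = ∑[ u < n ] ⟦ f u == y ⟧

∑-preimages : ∀ {n M} (f : Fin n → Fin M) → ∑[ y < M ] preimages f y ≡ n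
∑-preimages {n} f = trans (∑-comm λ y u → ⟦ f u == y ⟧) (trans (sum-cong-≗ (∑-indicator ∘ f)) (∑-const-1 n))

preimages-image : ∀ {n M} (f : Fin n → Fin M) u → 1 ≤ preimages f (f u)
preimages-image f u =
  subst (λ b → ⟦ b ⟧ ≤ preimages f (f u)) (dec-true (f u ≟ f u) refl) (∑-term-≤ (λ v → ⟦ f v == f u ⟧) u)

preimages-≤1 : ∀ {n M} (f : Fin n → Fin M) → Injective _≡_ _≡_ f → ∀ y → preimages f y ≤ 1
preimages-≤1 {n} f inj y = subst (_≤ 1) (sumMap-allFin (λ u → ⟦ f u == y ⟧))
  (sumMap-at-most-one (allFin n) (λ u → f u == y) (λ u v → ⟦ u == v ⟧)
    (λ u → trans (sumMap-allFin (λ v → ⟦ u == v ⟧)) (∑-indicator u)) same-preimage)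
  where
  same-preimage : ∀ u v → (f u == y) ≡ true → ⟦ f v == y ⟧ ≤ ⟦ u == v ⟧
  same-preimage u v fu≡y with f v ≟ y
  ... | no _    = z≤n
  ... | yes fv≡y = ≤-reflexive (cong ⟦_⟧ (sym (dec-true (u ≟ v) (inj (trans (does-true (f u ≟ y) fu≡y) (sym fv≡y))))))

preimages-bijection : ∀ {N} (L : Fin N → Fin N) → Injective _≡_ _≡_ L → ∀ y → preimages L y ≡ 1
preimages-bijection {N} L inj = ∑-squeeze (preimages-≤1 L inj) (trans (∑-preimages L) (sym (∑-const-1 N)))

isInjective-∷ : ∀ {n M} (c : Fin M) (g : Fin n → Fin M) →
  isInjective (c ∷ᵥ g) ≡ (preimages g c ≡ᵇ 0) ∧ isInjective g
isInjective-∷ c g = ⇔→≡ (mk⇔ to from)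
  where
  c-unused : Injective _≡_ _≡_ (c ∷ᵥ g) → preimages g c ≡ 0
  c-unused inj = ∑-zero λ u → cong ⟦_⟧ (dec-false (g u ≟ c) λ gu≡c → 0≢1+n (sym (inj {suc u} {zero} gu≡c)))
  c∉g : ∀ {u} → preimages g c ≡ 0 → g u ≢ c
  c∉g {u} none gu≡c = <-irrefl refl (≤-trans (subst (λ y → 1 ≤ preimages g y) gu≡c (preimages-image g u)) (≤-reflexive none))
  to : isInjective (c ∷ᵥ g) ≡ true → ((preimages g c ≡ᵇ 0) ∧ isInjective g) ≡ true
  to inj = cong₂ _∧_ (≡ᵇ-true (c-unused injective)) (injective⇒isInjective g (suc-injective ∘ injective))
    where injective = isInjective⇒injective (c ∷ᵥ g) inj
  from : ((preimages g c ≡ᵇ 0) ∧ isInjective g) ≡ true → isInjective (c ∷ᵥ g) ≡ true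
  from both = injective⇒isInjective (c ∷ᵥ g) injective
    where
    none : preimages g c ≡ 0
    none = does-true (preimages g c ≟ℕ 0) (proj₁ (∧-true both))
    injective : ∀ {u v} → (c ∷ᵥ g) u ≡ (c ∷ᵥ g) v → u ≡ v
    injective {zero}  {zero}  _     = refl
    injective {zero}  {suc v} c≡gv  = contradiction (sym c≡gv) (c∉g none)
    injective {suc u} {zero}  gu≡c  = contradiction gu≡c (c∉g none)
    injective {suc u} {suc v} gu≡gv = cong suc (isInjective⇒injective g (proj₂ (∧-true both)) gu≡gv)

∑-unused : ∀ {n M} (g : Fin n → Fin M) → Injective _≡_ _≡_ g → ∑[ c < M ] ⟦ preimages g c ≡ᵇ 0 ⟧ ≡ M ∸ n
∑-unused {n} {M} g inj = begin
  ∑[ c < M ] unused c                                   ≡⟨ m+n∸n≡m _ n ⟨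
  ∑[ c < M ] unused c + n ∸ n                           ≡⟨ cong (λ k → ∑[ c < M ] unused c + k ∸ n) (∑-preimages g) ⟨
  ∑[ c < M ] unused c + ∑[ c < M ] preimages g c ∸ n    ≡⟨ cong (_∸ n) (∑-distrib-+ unused (preimages g)) ⟨
  ∑[ c < M ] (unused c + preimages g c) ∸ n             ≡⟨ cong (_∸ n) (sum-cong-≗ λ c → unused-or-used (preimages-≤1 g inj c)) ⟩
  ∑[ c < M ] 1 ∸ n                                      ≡⟨ cong (_∸ n) (∑-const-1 M) ⟩
  M ∸ n                                                 ∎
  where
  open ≡-Reasoning
  unused : Fin M → ℕ
  unused c = ⟦ preimages g c ≡ᵇ 0 ⟧
  unused-or-used : ∀ {h} → h ≤ 1 → ⟦ h ≡ᵇ 0 ⟧ + h ≡ 1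
  unused-or-used {zero}  _ = refl
  unused-or-used {suc zero} _ = refl
  unused-or-used {suc (suc h)} (s≤s ())

count-injections : ∀ n M → ∑[ f ← allFuns n M ] ⟦ isInjective f ⟧ ≡ M P′ n
count-injections zero    M = refl
count-injections (suc n) M = begin
  ∑[ f ← allFuns (suc n) M ] ⟦ isInjective f ⟧
    ≡⟨ allFuns-suc n M _ (cong ⟦_⟧ ∘ isInjective-cong) ⟩
  ∑[ g ← allFuns n M ] ∑[ c < M ] ⟦ isInjective (c ∷ᵥ g) ⟧
    ≡⟨ sumMap-cong (allFuns n M) (λ g → sum-cong-≗ λ c →
         trans (cong ⟦_⟧ (isInjective-∷ c g)) (⟦∧⟧ (preimages g c ≡ᵇ 0) (isInjective g))) ⟩
  ∑[ g ← allFuns n M ] ∑[ c < M ] (unused g c * ⟦ isInjective g ⟧)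
    ≡⟨ sumMap-cong (allFuns n M) (λ g →
         trans (extensions g (isInjective g) refl) (*-distribʳ-sum ⟦ isInjective g ⟧ (unused g))) ⟨
  ∑[ g ← allFuns n M ] ((M ∸ n) * ⟦ isInjective g ⟧)
    ≡⟨ sumMap-*ˡ (allFuns n M) (M ∸ n) _ ⟨
  (M ∸ n) * ∑[ g ← allFuns n M ] ⟦ isInjective g ⟧
    ≡⟨ cong ((M ∸ n) *_) (count-injections n M) ⟩
  M P′ suc n
    ∎
  where
  open ≡-Reasoning
  unused : (Fin n → Fin M) → Fin M → ℕ
  unused g c = ⟦ preimages g c ≡ᵇ 0 ⟧
  extensions : ∀ g b → isInjective g ≡ b → (M ∸ n) * ⟦ b ⟧ ≡ ∑[ c < M ] unused g c * ⟦ b ⟧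
  extensions g true  inj = cong (_* 1) (sym (∑-unused g (isInjective⇒injective g inj)))
  extensions g false _   = trans (*-zeroʳ (M ∸ n)) (sym (*-zeroʳ (∑[ c < M ] unused g c)))

count-labelings : ∀ n → ∑[ L ← labelings n ] ⟦ isLabeling L ⟧ ≡ n !
count-labelings n = trans (count-injections n n) (nP′n≡n! n)

size : ∀ {N} → (Fin N → Fin 2) → ℕ
size {N} S = ∑[ x < N ] toℕ (S x)

count-subsets : ∀ N n → ∑[ S ← subsets N ] ⟦ size S ≡ᵇ n ⟧ ≡ N C n
count-subsets zero    zero    = refl
count-subsets zero    (suc n) = refl
count-subsets (suc N) n = begin
  ∑[ S ← subsets (suc N) ] ⟦ size S ≡ᵇ n ⟧
    ≡⟨ allFuns-suc N 2 _ (λ S≗S′ → cong (λ s → ⟦ s ≡ᵇ n ⟧) (sum-cong-≗ (cong toℕ ∘ S≗S′))) ⟩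
  ∑[ S ← subsets N ] (⟦ size S ≡ᵇ n ⟧ + (⟦ suc (size S) ≡ᵇ n ⟧ + 0))
    ≡⟨ sumMap-cong (subsets N) (λ S → cong (⟦ size S ≡ᵇ n ⟧ +_) (+-identityʳ _)) ⟩
  ∑[ S ← subsets N ] (⟦ size S ≡ᵇ n ⟧ + ⟦ suc (size S) ≡ᵇ n ⟧)
    ≡⟨ sumMap-distrib-+ (subsets N) _ _ ⟩
  ∑[ S ← subsets N ] ⟦ size S ≡ᵇ n ⟧ + ∑[ S ← subsets N ] ⟦ suc (size S) ≡ᵇ n ⟧
    ≡⟨ pascal n ⟩
  suc N C n
    ∎
  where
  open ≡-Reasoning
  pascal : ∀ n → ∑[ S ← subsets N ] ⟦ size S ≡ᵇ n ⟧ + ∑[ S ← subsets N ] ⟦ suc (size S) ≡ᵇ n ⟧ ≡ suc N C n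
  pascal zero    = cong₂ _+_ (count-subsets N 0) (sumMap-zero (subsets N) λ _ → refl)
  pascal (suc n) = trans (cong₂ _+_ (count-subsets N (suc n)) (count-subsets N n))
    (trans (+-comm (N C suc n) (N C n)) (nCk+nC[k+1]≡[n+1]C[k+1] N n))

binomial-factorial : ∀ n m → (n + m) ! ≡ ((n + m) C n) * (n ! * m !)
binomial-factorial n m = begin
  (n + m) !                                          ≡⟨ m/n*n≡m (k![n∸k]!∣n! (m≤m+n n m)) ⟨
  ((n + m) ! / (n ! * (n + m ∸ n) !)) * (n ! * (n + m ∸ n) !)
    ≡⟨ cong (_* (n ! * (n + m ∸ n) !)) (nCk≡n!/k![n-k]! (m≤m+n n m)) ⟨
  ((n + m) C n) * (n ! * (n + m ∸ n) !)                ≡⟨ cong (λ k → ((n + m) C n) * (n ! * k !)) (m+n∸m≡n n m) ⟩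
  ((n + m) C n) * (n ! * m !)                          ∎
  where
  open ≡-Reasoning
  instance _ = n !* (n + m ∸ n) !≢0

image : ∀ {n M} → (Fin n → Fin M) → Fin M → Fin 2
image f y = if preimages f y ≡ᵇ 0 then zero else suc zero

toℕ-image : ∀ {n M} (f : Fin n → Fin M) → Injective _≡_ _≡_ f → ∀ y → toℕ (image f y) ≡ preimages f y
toℕ-image f inj y = at-most-one (preimages-≤1 f inj y)
  where
  at-most-one : ∀ {h} → h ≤ 1 → toℕ {2} (if h ≡ᵇ 0 then zero else suc zero) ≡ h
  at-most-one {zero}        _ = refl
  at-most-one {suc zero}    _ = refl
  at-most-one {suc (suc h)} (s≤s ())

size-image : ∀ {n M} (f : Fin n → Fin M) → Injective _≡_ _≡_ f → size (image f) ≡ n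
size-image f inj = trans (sum-cong-≗ (toℕ-image f inj)) (∑-preimages f)

-- Standardization

infix 4 _<ᶠ_
_<ᶠ_ : ∀ {M} → Fin M → Fin M → Bool
x <ᶠ y = toℕ x <ᵇ toℕ y

<ᶠ-true : ∀ {M} {x y : Fin M} → toℕ x < toℕ y → (x <ᶠ y) ≡ true
<ᶠ-true {x = x} {y} = dec-true (toℕ x <? toℕ y)

<ᶠ-false : ∀ {M} {x y : Fin M} → ¬ toℕ x < toℕ y → (x <ᶠ y) ≡ false
<ᶠ-false {x = x} {y} = dec-false (toℕ x <? toℕ y)

<ᶠ-irrefl : ∀ {M} (x : Fin M) → (x <ᶠ x) ≡ false
<ᶠ-irrefl x = <ᶠ-false (n≮n (toℕ x))

<ᶠ-monoʳ : ∀ {M} (y : Fin M) {x x′} → toℕ x ≤ toℕ x′ → ⟦ y <ᶠ x ⟧ ≤ ⟦ y <ᶠ x′ ⟧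
<ᶠ-monoʳ y {x} {x′} x≤x′ with toℕ y <? toℕ x
... | yes y<x = ≤-reflexive (cong ⟦_⟧ (trans (<ᶠ-true y<x) (sym (<ᶠ-true (<-≤-trans y<x x≤x′)))))
... | no  y≮x = subst (λ b → ⟦ b ⟧ ≤ ⟦ y <ᶠ x′ ⟧) (sym (<ᶠ-false y≮x)) z≤n

⟦<ᶠ⟧-jump : ∀ {M} {x y : Fin M} → toℕ x < toℕ y → ⟦ x <ᶠ x ⟧ < ⟦ x <ᶠ y ⟧
⟦<ᶠ⟧-jump {x = x} x<y = subst₂ (λ a b → ⟦ a ⟧ < ⟦ b ⟧) (sym (<ᶠ-irrefl x)) (sym (<ᶠ-true x<y)) (s≤s z≤n)

rank : ∀ {n M} → (Fin n → Fin M) → Fin n → ℕ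
rank {n} f u = ∑[ v < n ] ⟦ f v <ᶠ f u ⟧

module _ {n M} (f : Fin n → Fin M) where

  rank-mono-≤ : ∀ {u v} → toℕ (f u) ≤ toℕ (f v) → rank f u ≤ rank f v
  rank-mono-≤ fu≤fv = ∑-mono-≤ λ w → <ᶠ-monoʳ (f w) fu≤fv

  rank-mono-< : ∀ {u v} → toℕ (f u) < toℕ (f v) → rank f u < rank f v
  rank-mono-< {u} fu<fv = ∑-mono-< u (λ w → <ᶠ-monoʳ (f w) (<⇒≤ fu<fv)) (⟦<ᶠ⟧-jump fu<fv)

  rank<n : ∀ u → rank f u < n
  rank<n u = subst (rank f u <_) (∑-const-1 n)
    (∑-mono-< u (λ v → ⟦⟧≤1 (f v <ᶠ f u)) (subst (λ b → ⟦ b ⟧ < 1) (sym (<ᶠ-irrefl (f u))) (s≤s z≤n)))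

  rank≡∑preimages : ∀ u → rank f u ≡ ∑[ y < M ] (preimages f y * ⟦ y <ᶠ f u ⟧)
  rank≡∑preimages u = begin
    ∑[ v < n ] ⟦ f v <ᶠ f u ⟧
      ≡⟨ sum-cong-≗ (λ v → ∑-delta (f v) λ y → ⟦ y <ᶠ f u ⟧) ⟨
    ∑[ v < n ] ∑[ y < M ] (⟦ f v == y ⟧ * ⟦ y <ᶠ f u ⟧)
      ≡⟨ ∑-comm (λ v y → ⟦ f v == y ⟧ * ⟦ y <ᶠ f u ⟧) ⟩
    ∑[ y < M ] ∑[ v < n ] (⟦ f v == y ⟧ * ⟦ y <ᶠ f u ⟧)
      ≡⟨ sum-cong-≗ (λ y → *-distribʳ-sum ⟦ y <ᶠ f u ⟧ (λ v → ⟦ f v == y ⟧)) ⟨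
    ∑[ y < M ] (preimages f y * ⟦ y <ᶠ f u ⟧)
      ∎
    where open ≡-Reasoning

standardize : ∀ {n M} → (Fin n → Fin M) → Fin n → Fin n
standardize f u = fromℕ< (rank<n f u)

toℕ-standardize : ∀ {n M} (f : Fin n → Fin M) u → toℕ (standardize f u) ≡ rank f u
toℕ-standardize f u = toℕ-fromℕ< (rank<n f u)

standardize-<ᶠ : ∀ {n M} (f : Fin n → Fin M) u v → (standardize f u <ᶠ standardize f v) ≡ (f u <ᶠ f v)
standardize-<ᶠ f u v with toℕ (f u) <? toℕ (f v)
... | yes fu<fv = trans (<ᶠ-true (rank-in-std (rank-mono-< f fu<fv))) (sym (<ᶠ-true fu<fv))
  where rank-in-std = subst₂ _<_ (sym (toℕ-standardize f u)) (sym (toℕ-standardize f v))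
... | no  fu≮fv = trans (<ᶠ-false (≤⇒≯ (rank-in-std (rank-mono-≤ f (≮⇒≥ fu≮fv))))) (sym (<ᶠ-false fu≮fv))
  where rank-in-std = subst₂ _≤_ (sym (toℕ-standardize f v)) (sym (toℕ-standardize f u))

standardize-injective : ∀ {n M} (f : Fin n → Fin M) → Injective _≡_ _≡_ f → Injective _≡_ _≡_ (standardize f)
standardize-injective f inj {u} {v} stdu≡stdv with <-cmp (toℕ (f u)) (toℕ (f v))
... | tri< fu<fv _ _ = contradiction same-rank (<⇒≢ (rank-mono-< f fu<fv))
  where same-rank = trans (sym (toℕ-standardize f u)) (trans (cong toℕ stdu≡stdv) (toℕ-standardize f v))
... | tri≈ _ fu≡fv _ = inj (toℕ-injective fu≡fv)
... | tri> _ _ fu>fv = contradiction same-rank (<⇒≢ (rank-mono-< f fu>fv))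
  where same-rank = trans (sym (toℕ-standardize f v)) (trans (cong toℕ (sym stdu≡stdv)) (toℕ-standardize f u))

rank-<-same-preimages : ∀ {n M} (f g : Fin n → Fin M) → preimages f ≗ preimages g →
  ∀ {u} → toℕ (f u) < toℕ (g u) → rank f u < rank g u
rank-<-same-preimages {M = M} f g same {u} fu<gu = begin-strict
  rank f u                                    ≡⟨ rank≡∑preimages f u ⟩
  ∑[ y < M ] (preimages f y * ⟦ y <ᶠ f u ⟧)   <⟨ ∑-mono-< (f u) below jump ⟩
  ∑[ y < M ] (preimages f y * ⟦ y <ᶠ g u ⟧)   ≡⟨ sum-cong-≗ (λ y → cong (_* ⟦ y <ᶠ g u ⟧) (same y)) ⟩
  ∑[ y < M ] (preimages g y * ⟦ y <ᶠ g u ⟧)   ≡⟨ rank≡∑preimages g u ⟨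
  rank g u                                    ∎
  where
  open ≤-Reasoning
  below : ∀ y → preimages f y * ⟦ y <ᶠ f u ⟧ ≤ preimages f y * ⟦ y <ᶠ g u ⟧
  below y = *-monoʳ-≤ (preimages f y) (<ᶠ-monoʳ y (<⇒≤ fu<gu))
  jump : preimages f (f u) * ⟦ f u <ᶠ f u ⟧ < preimages f (f u) * ⟦ f u <ᶠ g u ⟧
  jump = *-monoʳ-< (preimages f (f u)) {{>-nonZero (preimages-image f u)}} (⟦<ᶠ⟧-jump fu<gu)

standardize-preimages-determine : ∀ {n M} (f g : Fin n → Fin M) →
  preimages f ≗ preimages g → standardize f ≗ standardize g → f ≗ g
standardize-preimages-determine f g same standardize≗ u with <-cmp (toℕ (f u)) (toℕ (g u))
... | tri< fu<gu _ _ = contradiction same-rank (<⇒≢ (rank-<-same-preimages f g same fu<gu))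
  where same-rank = trans (sym (toℕ-standardize f u)) (trans (cong toℕ (standardize≗ u)) (toℕ-standardize g u))
... | tri≈ _ fu≡gu _ = toℕ-injective fu≡gu
... | tri> _ _ gu<fu = contradiction same-rank (<⇒≢ (rank-<-same-preimages g f (sym ∘ same) gu<fu))
  where same-rank = trans (sym (toℕ-standardize g u)) (trans (cong toℕ (sym (standardize≗ u))) (toℕ-standardize f u))

-- Shuffling the labelings of two disjoint vertex sets

-- shape is a bijection from the labelings of Fin (n + m) onto the valid shapes. Only its injectivity and
-- the validity of its values are proved directly: surjectivity then follows by counting, since
-- (n + m)! = C(n + m, n) · n! · m!.
module Shuffle (n m : ℕ) where

  Labeling : Set
  Labeling = Fin (n + m) → Fin (n + m)

  left : Labeling → Fin n → Fin (n + m)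
  left L = L ∘ (_↑ˡ m)

  right : Labeling → Fin m → Fin (n + m)
  right L = L ∘ (n ↑ʳ_)

  Shape : Set
  Shape = (Fin (n + m) → Fin 2) × (Fin n → Fin n) × (Fin m → Fin m)

  shape : Labeling → Shape
  shape L = image (left L) , standardize (left L) , standardize (right L)

  valid : Shape → Bool
  valid (S , A , B) = (size S ≡ᵇ n) ∧ isLabeling A ∧ isLabeling B

  shapes : List Shape
  shapes = cartesianProduct (subsets (n + m)) (cartesianProduct (labelings n) (labelings m))

  sumMap-shapes : ∀ (F : Shape → ℕ) →
    sumMap shapes F ≡ ∑[ S ← subsets (n + m) ] ∑[ A ← labelings n ] ∑[ B ← labelings m ] F (S , A , B)
  sumMap-shapes F = trans (sumMap-cartesianProduct (subsets (n + m)) _ F)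
    (sumMap-cong (subsets (n + m)) λ S → sumMap-cartesianProduct (labelings n) (labelings m) (F ∘ (S ,_)))

  infix 4 _≈_ _≈ᵇ_

  _≈_ : Shape → Shape → Set
  (S , A , B) ≈ (S′ , A′ , B′) = S ≗ S′ × A ≗ A′ × B ≗ B′

  _≈ᵇ_ : Shape → Shape → Bool
  (S , A , B) ≈ᵇ (S′ , A′ , B′) = (S ≗ᵇ S′) ∧ (A ≗ᵇ A′) ∧ (B ≗ᵇ B′)

  ≈ᵇ⇒≈ : ∀ t t′ → (t ≈ᵇ t′) ≡ true → t ≈ t′
  ≈ᵇ⇒≈ t t′ eq with ∧-true eq
  ... | S≗S′ , rest with ∧-true rest
  ... | A≗A′ , B≗B′ = ≗ᵇ⇒≗ S≗S′ , ≗ᵇ⇒≗ A≗A′ , ≗ᵇ⇒≗ B≗B′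

  ≈-sym : ∀ {t t′} → t ≈ t′ → t′ ≈ t
  ≈-sym (S≗ , A≗ , B≗) = sym ∘ S≗ , sym ∘ A≗ , sym ∘ B≗

  ≈-trans : ∀ {t t′ t″} → t ≈ t′ → t′ ≈ t″ → t ≈ t″
  ≈-trans (S≗ , A≗ , B≗) (S≗′ , A≗′ , B≗′) =
    (λ x → trans (S≗ x) (S≗′ x)) , (λ x → trans (A≗ x) (A≗′ x)) , (λ x → trans (B≗ x) (B≗′ x))

  ShapeExtensional : (Shape → ℕ) → Set
  ShapeExtensional W = ∀ {t t′} → t ≈ t′ → W t ≡ W t′

  valid-ext : ShapeExtensional (⟦_⟧ ∘ valid)
  valid-ext (S≗S′ , A≗A′ , B≗B′) = cong₂ (λ s ab → ⟦ (s ≡ᵇ n) ∧ ab ⟧)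
    (sum-cong-≗ (cong toℕ ∘ S≗S′)) (cong₂ _∧_ (isInjective-cong A≗A′) (isInjective-cong B≗B′))

  shapes-delta : ∀ t (W : Shape → ℕ) → ShapeExtensional W →
    ∑[ t′ ← shapes ] (⟦ t ≈ᵇ t′ ⟧ * W t′) ≡ W t
  shapes-delta (S₀ , A₀ , B₀) W W-ext = begin
    ∑[ t ← shapes ] (⟦ (S₀ , A₀ , B₀) ≈ᵇ t ⟧ * W t)
      ≡⟨ sumMap-shapes _ ⟩
    ∑[ S ← subsets (n + m) ] ∑[ A ← labelings n ] ∑[ B ← labelings m ]
      (⟦ (S₀ ≗ᵇ S) ∧ (A₀ ≗ᵇ A) ∧ (B₀ ≗ᵇ B) ⟧ * W (S , A , B))
      ≡⟨ sumMap-cong (subsets (n + m)) (λ S → sumMap-cong (labelings n) (pick-B S)) ⟩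
    ∑[ S ← subsets (n + m) ] ∑[ A ← labelings n ] (⟦ S₀ ≗ᵇ S ⟧ * (⟦ A₀ ≗ᵇ A ⟧ * W (S , A , B₀)))
      ≡⟨ sumMap-cong (subsets (n + m)) pick-A ⟩
    ∑[ S ← subsets (n + m) ] (⟦ S₀ ≗ᵇ S ⟧ * W (S , A₀ , B₀))
      ≡⟨ allFuns-delta (n + m) 2 S₀ _ (λ S≗S′ → W-ext (S≗S′ , (λ _ → refl) , (λ _ → refl))) ⟩
    W (S₀ , A₀ , B₀)
      ∎
    where
    open ≡-Reasoning
    pick-B : ∀ S A → ∑[ B ← labelings m ] (⟦ (S₀ ≗ᵇ S) ∧ (A₀ ≗ᵇ A) ∧ (B₀ ≗ᵇ B) ⟧ * W (S , A , B)) ≡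
                     ⟦ S₀ ≗ᵇ S ⟧ * (⟦ A₀ ≗ᵇ A ⟧ * W (S , A , B₀))
    pick-B S A = begin
      ∑[ B ← labelings m ] (⟦ (S₀ ≗ᵇ S) ∧ (A₀ ≗ᵇ A) ∧ (B₀ ≗ᵇ B) ⟧ * W (S , A , B))
        ≡⟨ sumMap-cong (labelings m) (λ B → ⟦∧∧⟧-* (S₀ ≗ᵇ S) (A₀ ≗ᵇ A) (B₀ ≗ᵇ B) (W (S , A , B))) ⟩
      ∑[ B ← labelings m ] (⟦ S₀ ≗ᵇ S ⟧ * (⟦ A₀ ≗ᵇ A ⟧ * (⟦ B₀ ≗ᵇ B ⟧ * W (S , A , B))))
        ≡⟨ trans (cong (⟦ S₀ ≗ᵇ S ⟧ *_) (sumMap-*ˡ (labelings m) ⟦ A₀ ≗ᵇ A ⟧ _))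
                 (sumMap-*ˡ (labelings m) ⟦ S₀ ≗ᵇ S ⟧ _) ⟨
      ⟦ S₀ ≗ᵇ S ⟧ * (⟦ A₀ ≗ᵇ A ⟧ * ∑[ B ← labelings m ] (⟦ B₀ ≗ᵇ B ⟧ * W (S , A , B)))
        ≡⟨ cong (λ w → ⟦ S₀ ≗ᵇ S ⟧ * (⟦ A₀ ≗ᵇ A ⟧ * w))
             (allFuns-delta m m B₀ _ λ B≗B′ → W-ext ((λ _ → refl) , (λ _ → refl) , B≗B′)) ⟩
      ⟦ S₀ ≗ᵇ S ⟧ * (⟦ A₀ ≗ᵇ A ⟧ * W (S , A , B₀))
        ∎
    pick-A : ∀ S → ∑[ A ← labelings n ] (⟦ S₀ ≗ᵇ S ⟧ * (⟦ A₀ ≗ᵇ A ⟧ * W (S , A , B₀))) ≡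
                   ⟦ S₀ ≗ᵇ S ⟧ * W (S , A₀ , B₀)
    pick-A S = trans (sym (sumMap-*ˡ (labelings n) ⟦ S₀ ≗ᵇ S ⟧ _))
      (cong (⟦ S₀ ≗ᵇ S ⟧ *_) (allFuns-delta n n A₀ _ λ A≗A′ → W-ext ((λ _ → refl) , A≗A′ , (λ _ → refl))))

  module _ (L : Labeling) (lab : isLabeling L ≡ true) where

    left-injective : Injective _≡_ _≡_ (left L)
    left-injective = ↑ˡ-injective m _ _ ∘ isInjective⇒injective L lab

    right-injective : Injective _≡_ _≡_ (right L)
    right-injective = ↑ʳ-injective n _ _ ∘ isInjective⇒injective L lab

    valid-shape : valid (shape L) ≡ true
    valid-shape = cong₂ _∧_
      (≡ᵇ-true (size-image (left L) left-injective))
      (cong₂ _∧_ (injective⇒isInjective _ (standardize-injective (left L) left-injective))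
                 (injective⇒isInjective _ (standardize-injective (right L) right-injective)))

    preimages-left+right : ∀ y → preimages (left L) y + preimages (right L) y ≡ 1
    preimages-left+right y =
      trans (sym (∑-++ n (λ u → ⟦ L u == y ⟧))) (preimages-bijection L (isInjective⇒injective L lab) y)

  shape-injective : ∀ {L L′} → isLabeling L ≡ true → isLabeling L′ ≡ true → shape L ≈ shape L′ → L ≗ L′
  shape-injective {L} {L′} lab lab′ (image≗ , stdˡ≗ , stdʳ≗) = ≗-++
    (standardize-preimages-determine (left L) (left L′) same-left stdˡ≗)
    (standardize-preimages-determine (right L) (right L′) same-right stdʳ≗)
    where
    same-left : preimages (left L) ≗ preimages (left L′)
    same-left y = trans (sym (toℕ-image (left L) (left-injective L lab) y))
      (trans (cong toℕ (image≗ y)) (toℕ-image (left L′) (left-injective L′ lab′) y))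
    same-right : preimages (right L) ≗ preimages (right L′)
    same-right y = +-cancelˡ-≡ (preimages (left L) y) _ _ (begin
      preimages (left L) y + preimages (right L) y    ≡⟨ preimages-left+right L lab y ⟩
      1                                               ≡⟨ preimages-left+right L′ lab′ y ⟨
      preimages (left L′) y + preimages (right L′) y  ≡⟨ cong (_+ preimages (right L′) y) (same-left y) ⟨
      preimages (left L) y + preimages (right L′) y   ∎)
      where open ≡-Reasoning

  fibre : Shape → ℕ
  fibre t = ∑[ L ← labelings (n + m) ] ⟦ isLabeling L ∧ (shape L ≈ᵇ t) ⟧

  sum-over-fibres : ∀ (W : Shape → ℕ) → ShapeExtensional W →
    ∑[ L ← labelings (n + m) ] (⟦ isLabeling L ⟧ * W (shape L)) ≡ ∑[ t ← shapes ] (fibre t * W t)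
  sum-over-fibres W W-ext = begin
    ∑[ L ← labelings (n + m) ] (⟦ isLabeling L ⟧ * W (shape L))
      ≡⟨ sumMap-cong (labelings (n + m)) (λ L → cong (⟦ isLabeling L ⟧ *_) (shapes-delta (shape L) W W-ext)) ⟨
    ∑[ L ← labelings (n + m) ] (⟦ isLabeling L ⟧ * ∑[ t ← shapes ] (⟦ shape L ≈ᵇ t ⟧ * W t))
      ≡⟨ sumMap-cong (labelings (n + m)) (λ L → sumMap-*ˡ shapes ⟦ isLabeling L ⟧ _) ⟩
    ∑[ L ← labelings (n + m) ] ∑[ t ← shapes ] (⟦ isLabeling L ⟧ * (⟦ shape L ≈ᵇ t ⟧ * W t))
      ≡⟨ sumMap-comm (labelings (n + m)) shapes _ ⟩
    ∑[ t ← shapes ] ∑[ L ← labelings (n + m) ] (⟦ isLabeling L ⟧ * (⟦ shape L ≈ᵇ t ⟧ * W t))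
      ≡⟨ sumMap-cong shapes (λ t → sumMap-cong (labelings (n + m)) λ L →
           trans (sym (*-assoc ⟦ isLabeling L ⟧ _ (W t))) (cong (_* W t) (sym (⟦∧⟧ (isLabeling L) _)))) ⟩
    ∑[ t ← shapes ] ∑[ L ← labelings (n + m) ] (⟦ isLabeling L ∧ (shape L ≈ᵇ t) ⟧ * W t)
      ≡⟨ sumMap-cong shapes (λ t → sumMap-*ʳ (labelings (n + m)) (W t) _) ⟨
    ∑[ t ← shapes ] (fibre t * W t)
      ∎
    where open ≡-Reasoning

  fibre-≤1 : ∀ t → fibre t ≤ 1
  fibre-≤1 t = sumMap-at-most-one (labelings (n + m)) (λ L → isLabeling L ∧ (shape L ≈ᵇ t)) (λ L L′ → ⟦ L ≗ᵇ L′ ⟧)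
    (λ L → trans (sumMap-cong (labelings (n + m)) λ L′ → sym (*-identityʳ ⟦ L ≗ᵇ L′ ⟧))
                 (allFuns-delta (n + m) (n + m) L (λ _ → 1) (λ _ → refl)))
    same-fibre
    where
    same-fibre : ∀ L L′ → (isLabeling L ∧ (shape L ≈ᵇ t)) ≡ true →
                 ⟦ isLabeling L′ ∧ (shape L′ ≈ᵇ t) ⟧ ≤ ⟦ L ≗ᵇ L′ ⟧
    same-fibre L L′ in-fibre with isLabeling L′ ∧ (shape L′ ≈ᵇ t) in in-fibre′
    ... | false = z≤n
    ... | true with ∧-true {isLabeling L} in-fibre | ∧-true {isLabeling L′} in-fibre′
    ... | lab , L≈t | lab′ , L′≈t = ≤-reflexive (cong ⟦_⟧ (sym (≗⇒≗ᵇ (shape-injective {L} {L′} lab lab′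
            (≈-trans {shape L} {t} (≈ᵇ⇒≈ (shape L) t L≈t) (≈-sym {shape L′} {t} (≈ᵇ⇒≈ (shape L′) t L′≈t)))))))

  fibre-≤-valid : ∀ t → fibre t ≤ ⟦ valid t ⟧
  fibre-≤-valid t with valid t in valid-t
  ... | true  = fibre-≤1 t
  ... | false = ≤-reflexive (sumMap-zero (labelings (n + m)) outside)
    where
    outside : ∀ L → ⟦ isLabeling L ∧ (shape L ≈ᵇ t) ⟧ ≡ 0
    outside L with isLabeling L ∧ (shape L ≈ᵇ t) in in-fibre
    ... | false = refl
    ... | true with ∧-true {isLabeling L} in-fibre
    ... | lab , L≈t = contradiction (begin
            1                  ≡⟨ cong ⟦_⟧ (valid-shape L lab) ⟨
            ⟦ valid (shape L) ⟧ ≡⟨ valid-ext {shape L} {t} (≈ᵇ⇒≈ (shape L) t L≈t) ⟩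
            ⟦ valid t ⟧         ≡⟨ cong ⟦_⟧ valid-t ⟩
            0                  ∎) (λ ())
      where open ≡-Reasoning

  weight : ((Fin n → Fin n) → ℕ) → ((Fin m → Fin m) → ℕ) → Shape → ℕ
  weight ψ₁ ψ₂ (_ , A , B) = ψ₁ A * ψ₂ B

  sum-valid : ∀ (ψ₁ : (Fin n → Fin n) → ℕ) (ψ₂ : (Fin m → Fin m) → ℕ) →
    ∑[ t ← shapes ] (⟦ valid t ⟧ * weight ψ₁ ψ₂ t) ≡
    ((n + m) C n) * (∑[ A ← labelings n ] (⟦ isLabeling A ⟧ * ψ₁ A) * ∑[ B ← labelings m ] (⟦ isLabeling B ⟧ * ψ₂ B))
  sum-valid ψ₁ ψ₂ = begin
    ∑[ t ← shapes ] (⟦ valid t ⟧ * weight ψ₁ ψ₂ t)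
      ≡⟨ sumMap-shapes _ ⟩
    ∑[ S ← subsets (n + m) ] ∑[ A ← labelings n ] ∑[ B ← labelings m ] (⟦ valid (S , A , B) ⟧ * (ψ₁ A * ψ₂ B))
      ≡⟨ sumMap-cong (subsets (n + m)) (λ S → sumMap-cong (labelings n) λ A → sumMap-cong (labelings m) λ B →
           trans (⟦∧∧⟧-* (size S ≡ᵇ n) (isLabeling A) (isLabeling B) _)
                 (cong (⟦ size S ≡ᵇ n ⟧ *_) (regroup ⟦ isLabeling A ⟧ ⟦ isLabeling B ⟧ (ψ₁ A) (ψ₂ B)))) ⟩
    ∑[ S ← subsets (n + m) ] ∑[ A ← labelings n ] ∑[ B ← labelings m ] (⟦ size S ≡ᵇ n ⟧ * (a A * b B))
      ≡⟨ sumMap-cong (subsets (n + m)) (λ S → sumMap₂-*ˡ (labelings n) (labelings m) ⟦ size S ≡ᵇ n ⟧ _) ⟨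
    ∑[ S ← subsets (n + m) ] (⟦ size S ≡ᵇ n ⟧ * ∑[ A ← labelings n ] ∑[ B ← labelings m ] (a A * b B))
      ≡⟨ sumMap-*ʳ (subsets (n + m)) _ _ ⟨
    ∑[ S ← subsets (n + m) ] ⟦ size S ≡ᵇ n ⟧ * ∑[ A ← labelings n ] ∑[ B ← labelings m ] (a A * b B)
      ≡⟨ cong₂ _*_ (count-subsets (n + m) n) (sumMap-product (labelings n) (labelings m) a b) ⟩
    ((n + m) C n) * (sumMap (labelings n) a * sumMap (labelings m) b)
      ∎
    where
    open ≡-Reasoning
    a : (Fin n → Fin n) → ℕ
    a A = ⟦ isLabeling A ⟧ * ψ₁ A
    b : (Fin m → Fin m) → ℕ
    b B = ⟦ isLabeling B ⟧ * ψ₂ B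
    regroup : ∀ x y u v → x * (y * (u * v)) ≡ (x * u) * (y * v)
    regroup = solve-∀

  sum-fibres≡sum-valid : sumMap shapes fibre ≡ sumMap shapes (⟦_⟧ ∘ valid)
  sum-fibres≡sum-valid = begin
    sumMap shapes fibre                                      ≡⟨ sumMap-cong shapes (λ t → *-identityʳ (fibre t)) ⟨
    ∑[ t ← shapes ] (fibre t * 1)                            ≡⟨ sum-over-fibres (λ _ → 1) (λ _ → refl) ⟨
    ∑[ L ← labelings (n + m) ] (⟦ isLabeling L ⟧ * 1)        ≡⟨ count-labelings′ (n + m) ⟩
    (n + m) !                                                ≡⟨ binomial-factorial n m ⟩
    ((n + m) C n) * (n ! * m !)                              ≡⟨ cong₂ (λ a b → ((n + m) C n) * (a * b))
                                                                      (count-labelings′ n) (count-labelings′ m) ⟨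
    ((n + m) C n) * (∑[ A ← labelings n ] (⟦ isLabeling A ⟧ * 1) * ∑[ B ← labelings m ] (⟦ isLabeling B ⟧ * 1))
                                                             ≡⟨ sum-valid (λ _ → 1) (λ _ → 1) ⟨
    ∑[ t ← shapes ] (⟦ valid t ⟧ * 1)                        ≡⟨ sumMap-cong shapes (λ t → *-identityʳ ⟦ valid t ⟧) ⟩
    sumMap shapes (⟦_⟧ ∘ valid)                              ∎
    where
    open ≡-Reasoning
    count-labelings′ : ∀ k → ∑[ L ← labelings k ] (⟦ isLabeling L ⟧ * 1) ≡ k !
    count-labelings′ k = trans (sumMap-cong (labelings k) λ L → *-identityʳ ⟦ isLabeling L ⟧) (count-labelings k)

  shuffle : ∀ (ψ₁ : (Fin n → Fin n) → ℕ) (ψ₂ : (Fin m → Fin m) → ℕ) → Extensional ψ₁ → Extensional ψ₂ →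
    ∑[ L ← labelings (n + m) ] (⟦ isLabeling L ⟧ * (ψ₁ (standardize (left L)) * ψ₂ (standardize (right L)))) ≡
    ((n + m) C n) * (∑[ A ← labelings n ] (⟦ isLabeling A ⟧ * ψ₁ A) * ∑[ B ← labelings m ] (⟦ isLabeling B ⟧ * ψ₂ B))
  shuffle ψ₁ ψ₂ ψ₁-ext ψ₂-ext = begin
    ∑[ L ← labelings (n + m) ] (⟦ isLabeling L ⟧ * weight ψ₁ ψ₂ (shape L))
      ≡⟨ sum-over-fibres (weight ψ₁ ψ₂) (λ (_ , A≗A′ , B≗B′) → cong₂ _*_ (ψ₁-ext A≗A′) (ψ₂-ext B≗B′)) ⟩
    ∑[ t ← shapes ] (fibre t * weight ψ₁ ψ₂ t)
      ≡⟨ sumMap-squeeze shapes (weight ψ₁ ψ₂) fibre-≤-valid sum-fibres≡sum-valid ⟩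
    ∑[ t ← shapes ] (⟦ valid t ⟧ * weight ψ₁ ψ₂ t)
      ≡⟨ sum-valid ψ₁ ψ₂ ⟩
    ((n + m) C n) * (∑[ A ← labelings n ] (⟦ isLabeling A ⟧ * ψ₁ A) * ∑[ B ← labelings m ] (⟦ isLabeling B ⟧ * ψ₂ B))
      ∎
    where open ≡-Reasoning

-- Cauchy products

upTo-delta : ∀ a N (g : ℕ → ℕ) → ∑[ i ← upTo N ] (⟦ a ≡ᵇ i ⟧ * g i) ≡ ⟦ a <ᵇ N ⟧ * g a
upTo-delta a zero    g = refl
upTo-delta a (suc N) g = begin
  ∑[ i ← upTo (suc N) ] (⟦ a ≡ᵇ i ⟧ * g i)
    ≡⟨ cong (λ is → ∑[ i ← is ] (⟦ a ≡ᵇ i ⟧ * g i)) (upTo-∷ʳ N) ⟨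
  ∑[ i ← upTo N List.∷ʳ N ] (⟦ a ≡ᵇ i ⟧ * g i)
    ≡⟨ sumMap-++ (upTo N) (N ∷ []) _ ⟩
  ∑[ i ← upTo N ] (⟦ a ≡ᵇ i ⟧ * g i) + (⟦ a ≡ᵇ N ⟧ * g N + 0)
    ≡⟨ cong (_+ (⟦ a ≡ᵇ N ⟧ * g N + 0)) (upTo-delta a N g) ⟩
  ⟦ a <ᵇ N ⟧ * g a + (⟦ a ≡ᵇ N ⟧ * g N + 0)
    ≡⟨ last-index ⟩
  ⟦ a <ᵇ suc N ⟧ * g a
    ∎
  where
  open ≡-Reasoning
  last-index : ⟦ a <ᵇ N ⟧ * g a + (⟦ a ≡ᵇ N ⟧ * g N + 0) ≡ ⟦ a <ᵇ suc N ⟧ * g a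
  last-index with <-cmp a N
  ... | tri< a<N a≢N _ rewrite <ᵇ-true a<N | ≡ᵇ-false a≢N | <ᵇ-true (m<n⇒m<1+n a<N) = +-identityʳ _
  ... | tri≈ _ refl _  rewrite <ᵇ-false (n≮n a) | ≡ᵇ-true (refl {x = a}) | <ᵇ-true (n<1+n a) = +-identityʳ _
  ... | tri> _ a≢N N<a rewrite <ᵇ-false (<⇒≯ N<a) | ≡ᵇ-false a≢N | <ᵇ-false (≤⇒≯ N<a) = refl

indicator-+ : ∀ a b j → ⟦ a + b ≡ᵇ j ⟧ ≡ ∑[ i ← upTo (suc j) ] (⟦ a ≡ᵇ i ⟧ * ⟦ b ≡ᵇ j ∸ i ⟧)
indicator-+ a b j = begin
  ⟦ a + b ≡ᵇ j ⟧                                         ≡⟨ cong ⟦_⟧ (a≤j∧b≡j∸a (a ≤? j)) ⟨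
  ⟦ (a <ᵇ suc j) ∧ (b ≡ᵇ j ∸ a) ⟧                        ≡⟨ ⟦∧⟧ (a <ᵇ suc j) _ ⟩
  ⟦ a <ᵇ suc j ⟧ * ⟦ b ≡ᵇ j ∸ a ⟧                        ≡⟨ upTo-delta a (suc j) (λ i → ⟦ b ≡ᵇ j ∸ i ⟧) ⟨
  ∑[ i ← upTo (suc j) ] (⟦ a ≡ᵇ i ⟧ * ⟦ b ≡ᵇ j ∸ i ⟧)   ∎
  where
  open ≡-Reasoning
  a≤j∧b≡j∸a : Dec (a ≤ j) → ((a <ᵇ suc j) ∧ (b ≡ᵇ j ∸ a)) ≡ (a + b ≡ᵇ j)
  a≤j∧b≡j∸a (yes a≤j) rewrite <ᵇ-true (s≤s a≤j) = does-⇔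
    (mk⇔ (λ b≡j∸a → trans (cong (a +_) b≡j∸a) (m+[n∸m]≡n a≤j)) (λ a+b≡j → trans (sym (m+n∸m≡n a b)) (cong (_∸ a) a+b≡j)))
    (b ≟ℕ j ∸ a) (a + b ≟ℕ j)
  a≤j∧b≡j∸a (no a≰j) rewrite <ᵇ-false (a≰j ∘ ≤-pred) =
    sym (≡ᵇ-false λ a+b≡j → a≰j (subst (a ≤_) a+b≡j (m≤m+n a b)))

matches : ∀ {k} → (Fin k → ℕ) → Vec ℕ k → Bool
matches x α = allB (λ c → x c ≡ᵇ lookup α c)

matches-∷ : ∀ {k} (x : Fin (suc k) → ℕ) a (α : Vec ℕ k) → matches x (a ∷ α) ≡ (x zero ≡ᵇ a) ∧ matches (x ∘ suc) α
matches-∷ x a α = allB-suc (λ c → x c ≡ᵇ lookup (a ∷ α) c)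

splits-indicator : ∀ {k} (α : Vec ℕ k) (x y : Fin k → ℕ) →
  sumMap (splits α) (λ (β , γ) → ⟦ matches x β ⟧ * ⟦ matches y γ ⟧) ≡ ⟦ matches (λ c → x c + y c) α ⟧
splits-indicator []      x y = refl
splits-indicator (a ∷ α) x y = begin
  sumMap (splits (a ∷ α)) both
    ≡⟨ sumMap-concatMap (λ i → map (extend i) (splits α)) (upTo (suc a)) both ⟩
  ∑[ i ← upTo (suc a) ] sumMap (map (extend i) (splits α)) both
    ≡⟨ sumMap-cong (upTo (suc a)) (λ i → trans (sumMap-map (extend i) (splits α) both)
         (sumMap-cong (splits α) λ (β , γ) → split-heads i β γ)) ⟩
  ∑[ i ← upTo (suc a) ] sumMap (splits α) (λ (β , γ) → heads i * (⟦ matches (x ∘ suc) β ⟧ * ⟦ matches (y ∘ suc) γ ⟧))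
    ≡⟨ sumMap-cong (upTo (suc a)) (λ i → trans (sym (sumMap-*ˡ (splits α) (heads i) _))
         (cong (heads i *_) (splits-indicator α (x ∘ suc) (y ∘ suc)))) ⟩
  ∑[ i ← upTo (suc a) ] (heads i * ⟦ matches (λ c → x (suc c) + y (suc c)) α ⟧)
    ≡⟨ sumMap-*ʳ (upTo (suc a)) _ heads ⟨
  ∑[ i ← upTo (suc a) ] heads i * ⟦ matches (λ c → x (suc c) + y (suc c)) α ⟧
    ≡⟨ cong (_* ⟦ matches (λ c → x (suc c) + y (suc c)) α ⟧) (indicator-+ (x zero) (y zero) a) ⟨
  ⟦ x zero + y zero ≡ᵇ a ⟧ * ⟦ matches (λ c → x (suc c) + y (suc c)) α ⟧
    ≡⟨ trans (sym (⟦∧⟧ (x zero + y zero ≡ᵇ a) _)) (cong ⟦_⟧ (sym (matches-∷ (λ c → x c + y c) a α))) ⟩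
  ⟦ matches (λ c → x c + y c) (a ∷ α) ⟧
    ∎
  where
  open ≡-Reasoning
  both : Vec ℕ _ × Vec ℕ _ → ℕ
  both (β , γ) = ⟦ matches x β ⟧ * ⟦ matches y γ ⟧
  extend : ℕ → Vec ℕ _ × Vec ℕ _ → Vec ℕ _ × Vec ℕ _
  extend i (β , γ) = (i ∷ β , (a ∸ i) ∷ γ)
  heads : ℕ → ℕ
  heads i = ⟦ x zero ≡ᵇ i ⟧ * ⟦ y zero ≡ᵇ a ∸ i ⟧
  split-heads : ∀ i β γ → both (extend i (β , γ)) ≡ heads i * (⟦ matches (x ∘ suc) β ⟧ * ⟦ matches (y ∘ suc) γ ⟧)
  split-heads i β γ = begin
    ⟦ matches x (i ∷ β) ⟧ * ⟦ matches y ((a ∸ i) ∷ γ) ⟧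
      ≡⟨ cong₂ (λ p q → ⟦ p ⟧ * ⟦ q ⟧) (matches-∷ x i β) (matches-∷ y (a ∸ i) γ) ⟩
    ⟦ (x zero ≡ᵇ i) ∧ matches (x ∘ suc) β ⟧ * ⟦ (y zero ≡ᵇ a ∸ i) ∧ matches (y ∘ suc) γ ⟧
      ≡⟨ cong₂ _*_ (⟦∧⟧ (x zero ≡ᵇ i) _) (⟦∧⟧ (y zero ≡ᵇ a ∸ i) _) ⟩
    (⟦ x zero ≡ᵇ i ⟧ * ⟦ matches (x ∘ suc) β ⟧) * (⟦ y zero ≡ᵇ a ∸ i ⟧ * ⟦ matches (y ∘ suc) γ ⟧)
      ≡⟨ *-interchange ⟦ x zero ≡ᵇ i ⟧ _ _ _ ⟩
    heads i * (⟦ matches (x ∘ suc) β ⟧ * ⟦ matches (y ∘ suc) γ ⟧)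
      ∎

-- (A ⊛ B) k α j unfolds to cauchy (A k) (B k) α j.
cauchy : ∀ {k} → (Vec ℕ k → ℕ → ℕ) → (Vec ℕ k → ℕ → ℕ) → Vec ℕ k → ℕ → ℕ
cauchy a b α j = sumMap (splits α) (λ (β , γ) → ∑[ i ← upTo (suc j) ] (a β i * b γ (j ∸ i)))

cauchy-cong : ∀ {k} {a a′ b b′ : Vec ℕ k → ℕ → ℕ} → (∀ β i → a β i ≡ a′ β i) → (∀ γ i → b γ i ≡ b′ γ i) →
  ∀ α j → cauchy a b α j ≡ cauchy a′ b′ α j
cauchy-cong a≗a′ b≗b′ α j =
  sumMap-cong (splits α) λ (β , γ) → sumMap-cong (upTo (suc j)) λ i → cong₂ _*_ (a≗a′ β i) (b≗b′ γ (j ∸ i))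

cauchy-monomials : ∀ {k} (α : Vec ℕ k) j (x y : Fin k → ℕ) (f g : ℕ → ℕ) →
  cauchy (λ β i → ⟦ matches x β ⟧ * f i) (λ γ i → ⟦ matches y γ ⟧ * g i) α j
    ≡ ⟦ matches (λ c → x c + y c) α ⟧ * ∑[ i ← upTo (suc j) ] (f i * g (j ∸ i))
cauchy-monomials α j x y f g = begin
  sumMap (splits α) (λ (β , γ) → ∑[ i ← upTo (suc j) ] ((⟦ matches x β ⟧ * f i) * (⟦ matches y γ ⟧ * g (j ∸ i))))
    ≡⟨ sumMap-cong (splits α) (λ (β , γ) → trans
         (sumMap-cong (upTo (suc j)) λ i → *-interchange ⟦ matches x β ⟧ (f i) _ _)
         (sym (sumMap-*ˡ (upTo (suc j)) (⟦ matches x β ⟧ * ⟦ matches y γ ⟧) _))) ⟩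
  sumMap (splits α) (λ (β , γ) → (⟦ matches x β ⟧ * ⟦ matches y γ ⟧) * ∑[ i ← upTo (suc j) ] (f i * g (j ∸ i)))
    ≡⟨ sumMap-*ʳ (splits α) _ _ ⟨
  sumMap (splits α) (λ (β , γ) → ⟦ matches x β ⟧ * ⟦ matches y γ ⟧) * ∑[ i ← upTo (suc j) ] (f i * g (j ∸ i))
    ≡⟨ cong (_* ∑[ i ← upTo (suc j) ] (f i * g (j ∸ i))) (splits-indicator α x y) ⟩
  ⟦ matches (λ c → x c + y c) α ⟧ * ∑[ i ← upTo (suc j) ] (f i * g (j ∸ i))
    ∎
  where open ≡-Reasoning

cauchy-sumMap : ∀ {k} (xs : List A) (ys : List B) (a : A → Vec ℕ k → ℕ → ℕ) (b : B → Vec ℕ k → ℕ → ℕ) α j →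
  cauchy (λ β i → ∑[ x ← xs ] a x β i) (λ γ i → ∑[ y ← ys ] b y γ i) α j ≡ ∑[ x ← xs ] ∑[ y ← ys ] cauchy (a x) (b y) α j
cauchy-sumMap xs ys a b α j = begin
  sumMap (splits α) (λ (β , γ) → ∑[ i ← upTo (suc j) ] (∑[ x ← xs ] a x β i * ∑[ y ← ys ] b y γ (j ∸ i)))
    ≡⟨ sumMap-cong (splits α) (λ (β , γ) → trans
         (sumMap-cong (upTo (suc j)) λ i → sym (sumMap-product xs ys (λ x → a x β i) (λ y → b y γ (j ∸ i))))
         (sumMap-comm₂ (upTo (suc j)) xs ys _)) ⟩
  sumMap (splits α) (λ (β , γ) → ∑[ x ← xs ] ∑[ y ← ys ] ∑[ i ← upTo (suc j) ] (a x β i * b y γ (j ∸ i)))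
    ≡⟨ sumMap-comm₂ (splits α) xs ys _ ⟩
  ∑[ x ← xs ] ∑[ y ← ys ] cauchy (a x) (b y) α j
    ∎
  where
  open ≡-Reasoning
  sumMap-comm₂ : ∀ {C : Set} (zs : List C) (xs : List A) (ys : List B) (f : C → A → B → ℕ) →
    ∑[ z ← zs ] ∑[ x ← xs ] ∑[ y ← ys ] f z x y ≡ ∑[ x ← xs ] ∑[ y ← ys ] ∑[ z ← zs ] f z x y
  sumMap-comm₂ zs xs ys f = trans (sumMap-comm zs xs _) (sumMap-cong xs λ x → sumMap-comm zs ys (λ z → f z x))

-- Colorings and labelings of a disjoint union

isProperAt : ∀ {p k} → SimpleGraph p → (Fin p → Fin k) → Fin p → Fin p → Bool
isProperAt G κ u v = not (adj G u v) ∨ not (κ u == κ v)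

-- Generalizes asc to label maps into any Fin M, such as the restrictions of a labeling.
isAscent : ∀ {p M k} → SimpleGraph p → (Fin p → Fin M) → (Fin p → Fin k) → Fin p → Fin p → Bool
isAscent G f κ u v = adj G u v ∧ (f u <ᶠ f v) ∧ (κ u <ᶠ κ v)

ascents : ∀ {p M k} → SimpleGraph p → (Fin p → Fin M) → (Fin p → Fin k) → ℕ
ascents {p} G f κ = ∑[ u < p ] ∑[ v < p ] ⟦ isAscent G f κ u v ⟧

asc≡ascents : ∀ {p k} (G : SimpleGraph p) (L : Fin p → Fin p) (κ : Fin p → Fin k) → asc G L κ ≡ ascents G L κ
asc≡ascents {p} G L κ = trans (sumMap-allFin λ u → countB λ v → adj G u v ∧ (L u <ᶠ L v) ∧ (κ u <ᶠ κ v))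
  (sum-cong-≗ λ u → sumMap-allFin λ v → ⟦ adj G u v ∧ (L u <ᶠ L v) ∧ (κ u <ᶠ κ v) ⟧)

ascents-order-invariant : ∀ {p M M′ k} (G : SimpleGraph p) (κ : Fin p → Fin k) (f : Fin p → Fin M) (g : Fin p → Fin M′) →
  (∀ u v → (f u <ᶠ f v) ≡ (g u <ᶠ g v)) → ascents G f κ ≡ ascents G g κ
ascents-order-invariant G κ f g same-order =
  sum-cong-≗ λ u → sum-cong-≗ λ v → cong (λ b → ⟦ adj G u v ∧ b ∧ (κ u <ᶠ κ v) ⟧) (same-order u v)

ascents-cong : ∀ {p M k} (G : SimpleGraph p) (f : Fin p → Fin M) {κ κ′ : Fin p → Fin k} →
  κ ≗ κ′ → ascents G f κ ≡ ascents G f κ′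
ascents-cong G f κ≗κ′ =
  sum-cong-≗ λ u → sum-cong-≗ λ v → cong (λ b → ⟦ adj G u v ∧ (f u <ᶠ f v) ∧ b ⟧) (cong₂ _<ᶠ_ (κ≗κ′ u) (κ≗κ′ v))

preimages-++ : ∀ {n m k} (κ₁ : Fin n → Fin k) (κ₂ : Fin m → Fin k) c →
  preimages (κ₁ ++ κ₂) c ≡ preimages κ₁ c + preimages κ₂ c
preimages-++ {n} κ₁ κ₂ c = trans (∑-++ n (λ u → ⟦ (κ₁ ++ κ₂) u == c ⟧)) (cong₂ _+_
  (sum-cong-≗ λ a → cong (λ x → ⟦ x == c ⟧) (lookup-++ˡ κ₁ κ₂ a))
  (sum-cong-≗ λ b → cong (λ x → ⟦ x == c ⟧) (lookup-++ʳ κ₁ κ₂ b)))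

module _ {n m} (G : SimpleGraph n) (G′ : SimpleGraph m) where

  ⊔-adj-↑ˡ-↑ˡ : ∀ a b → adj (G ⊔ G′) (a ↑ˡ m) (b ↑ˡ m) ≡ adj G a b
  ⊔-adj-↑ˡ-↑ˡ a b rewrite splitAt-↑ˡ n a m | splitAt-↑ˡ n b m = refl

  ⊔-adj-↑ˡ-↑ʳ : ∀ a b → adj (G ⊔ G′) (a ↑ˡ m) (n ↑ʳ b) ≡ false
  ⊔-adj-↑ˡ-↑ʳ a b rewrite splitAt-↑ˡ n a m | splitAt-↑ʳ n m b = refl

  ⊔-adj-↑ʳ-↑ˡ : ∀ a b → adj (G ⊔ G′) (n ↑ʳ a) (b ↑ˡ m) ≡ false
  ⊔-adj-↑ʳ-↑ˡ a b rewrite splitAt-↑ʳ n m a | splitAt-↑ˡ n b m = refl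

  ⊔-adj-↑ʳ-↑ʳ : ∀ a b → adj (G ⊔ G′) (n ↑ʳ a) (n ↑ʳ b) ≡ adj G′ a b
  ⊔-adj-↑ʳ-↑ʳ a b rewrite splitAt-↑ʳ n m a | splitAt-↑ʳ n m b = refl

  isProper-⊔ : ∀ {k} (κ₁ : Fin n → Fin k) (κ₂ : Fin m → Fin k) →
    isProper (G ⊔ G′) (κ₁ ++ κ₂) ≡ isProper G κ₁ ∧ isProper G′ κ₂
  isProper-⊔ κ₁ κ₂ = trans (allB-++ n _) (cong₂ _∧_
    (allB-cong λ a → trans (allB-++ n _) (trans (cong₂ _∧_ (allB-cong (left-left a)) (allB-intro _ (left-right a))) (∧-identityʳ _)))
    (allB-cong λ a → trans (allB-++ n _) (cong₂ _∧_ (allB-intro _ (right-left a)) (allB-cong (right-right a)))))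
    where
    κ = κ₁ ++ κ₂
    non-edge : ∀ {u v} → adj (G ⊔ G′) u v ≡ false → isProperAt (G ⊔ G′) κ u v ≡ true
    non-edge {u} {v} = cong (λ e → not e ∨ not (κ u == κ v))
    left-left : ∀ a b → isProperAt (G ⊔ G′) κ (a ↑ˡ m) (b ↑ˡ m) ≡ isProperAt G κ₁ a b
    left-left a b = cong₂ (λ e c → not e ∨ not c) (⊔-adj-↑ˡ-↑ˡ a b) (cong₂ _==_ (lookup-++ˡ κ₁ κ₂ a) (lookup-++ˡ κ₁ κ₂ b))
    right-right : ∀ a b → isProperAt (G ⊔ G′) κ (n ↑ʳ a) (n ↑ʳ b) ≡ isProperAt G′ κ₂ a b
    right-right a b = cong₂ (λ e c → not e ∨ not c) (⊔-adj-↑ʳ-↑ʳ a b) (cong₂ _==_ (lookup-++ʳ κ₁ κ₂ a) (lookup-++ʳ κ₁ κ₂ b))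
    left-right : ∀ a b → isProperAt (G ⊔ G′) κ (a ↑ˡ m) (n ↑ʳ b) ≡ true
    left-right a b = non-edge (⊔-adj-↑ˡ-↑ʳ a b)
    right-left : ∀ a b → isProperAt (G ⊔ G′) κ (n ↑ʳ a) (b ↑ˡ m) ≡ true
    right-left a b = non-edge (⊔-adj-↑ʳ-↑ˡ a b)

  ascents-⊔ : ∀ {M k} (L : Fin (n + m) → Fin M) (κ₁ : Fin n → Fin k) (κ₂ : Fin m → Fin k) →
    ascents (G ⊔ G′) L (κ₁ ++ κ₂) ≡ ascents G (L ∘ (_↑ˡ m)) κ₁ + ascents G′ (L ∘ (n ↑ʳ_)) κ₂
  ascents-⊔ L κ₁ κ₂ = trans (∑-++ n _) (cong₂ _+_
    (sum-cong-≗ λ a → trans (∑-++ n _) (trans (cong₂ _+_ (sum-cong-≗ (left-left a)) (∑-zero (left-right a))) (+-identityʳ _)))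
    (sum-cong-≗ λ a → trans (∑-++ n _) (cong₂ _+_ (∑-zero (right-left a)) (sum-cong-≗ (right-right a)))))
    where
    κ = κ₁ ++ κ₂
    non-edge : ∀ {u v} → adj (G ⊔ G′) u v ≡ false → ⟦ isAscent (G ⊔ G′) L κ u v ⟧ ≡ 0
    non-edge {u} {v} = cong (λ e → ⟦ e ∧ (L u <ᶠ L v) ∧ (κ u <ᶠ κ v) ⟧)
    left-left : ∀ a b → ⟦ isAscent (G ⊔ G′) L κ (a ↑ˡ m) (b ↑ˡ m) ⟧ ≡ ⟦ isAscent G (L ∘ (_↑ˡ m)) κ₁ a b ⟧
    left-left a b = cong₂ (λ e c → ⟦ e ∧ (L (a ↑ˡ m) <ᶠ L (b ↑ˡ m)) ∧ c ⟧)
      (⊔-adj-↑ˡ-↑ˡ a b) (cong₂ _<ᶠ_ (lookup-++ˡ κ₁ κ₂ a) (lookup-++ˡ κ₁ κ₂ b))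
    right-right : ∀ a b → ⟦ isAscent (G ⊔ G′) L κ (n ↑ʳ a) (n ↑ʳ b) ⟧ ≡ ⟦ isAscent G′ (L ∘ (n ↑ʳ_)) κ₂ a b ⟧
    right-right a b = cong₂ (λ e c → ⟦ e ∧ (L (n ↑ʳ a) <ᶠ L (n ↑ʳ b)) ∧ c ⟧)
      (⊔-adj-↑ʳ-↑ʳ a b) (cong₂ _<ᶠ_ (lookup-++ʳ κ₁ κ₂ a) (lookup-++ʳ κ₁ κ₂ b))
    left-right : ∀ a b → ⟦ isAscent (G ⊔ G′) L κ (a ↑ˡ m) (n ↑ʳ b) ⟧ ≡ 0
    left-right a b = non-edge (⊔-adj-↑ˡ-↑ʳ a b)
    right-left : ∀ a b → ⟦ isAscent (G ⊔ G′) L κ (n ↑ʳ a) (b ↑ˡ m) ⟧ ≡ 0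
    right-left a b = non-edge (⊔-adj-↑ʳ-↑ˡ a b)

ascentCount : ∀ {p k} → SimpleGraph p → (Fin p → Fin k) → ℕ → ℕ
ascentCount {p} H κ i = ∑[ L ← labelings p ] (⟦ isLabeling L ⟧ * ⟦ ascents H L κ ≡ᵇ i ⟧)

properAscentCount : ∀ {p k} → SimpleGraph p → (Fin p → Fin k) → ℕ → ℕ
properAscentCount H κ i = ⟦ isProper H κ ⟧ * ascentCount H κ i

properAscentCount-ext : ∀ {p k} (H : SimpleGraph p) i → Extensional {p} {k} (λ κ → properAscentCount H κ i)
properAscentCount-ext {p} H i κ≗κ′ = cong₂ _*_
  (cong ⟦_⟧ (allB-cong λ u → allB-cong λ v → cong (λ b → not (adj H u v) ∨ not b) (cong₂ _==_ (κ≗κ′ u) (κ≗κ′ v))))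
  (sumMap-cong (labelings p) λ L → cong (λ a → ⟦ isLabeling L ⟧ * ⟦ a ≡ᵇ i ⟧) (ascents-cong H L κ≗κ′))

coloringTerm : ∀ {p k} → SimpleGraph p → (Fin p → Fin k) → Vec ℕ k → ℕ → ℕ
coloringTerm H κ β i = ⟦ matches (preimages κ) β ⟧ * properAscentCount H κ i

coloringTerm-ext : ∀ {p k} (H : SimpleGraph p) (β : Vec ℕ k) i → Extensional (λ κ → coloringTerm H κ β i)
coloringTerm-ext H β i κ≗κ′ = cong₂ _*_
  (cong ⟦_⟧ (allB-cong λ c → cong (_≡ᵇ lookup β c) (sum-cong-≗ λ u → cong (λ y → ⟦ y == c ⟧) (κ≗κ′ u))))
  (properAscentCount-ext H i κ≗κ′)

Tχ-by-colorings : ∀ {p} (H : SimpleGraph p) k (β : Vec ℕ k) i →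
  Tχ H k β i ≡ ∑[ κ ← allFuns p k ] coloringTerm H κ β i
Tχ-by-colorings {p} H k β i = begin
  Tχ H k β i
    ≡⟨ sumMap-comm (labelings p) (allFuns p k) _ ⟩
  ∑[ κ ← allFuns p k ] ∑[ L ← labelings p ] ⟦ isLabeling L ∧ isProper H κ ∧ hasContent κ β ∧ (asc H L κ ≡ᵇ i) ⟧
    ≡⟨ sumMap-cong (allFuns p k) (λ κ → sumMap-cong (labelings p) λ L → factor L κ) ⟩
  ∑[ κ ← allFuns p k ] ∑[ L ← labelings p ] (content κ * (proper κ * (⟦ isLabeling L ⟧ * ⟦ ascents H L κ ≡ᵇ i ⟧)))
    ≡⟨ sumMap-cong (allFuns p k) (λ κ → trans (sym (sumMap-*ˡ (labelings p) (content κ) _))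
         (cong (content κ *_) (sym (sumMap-*ˡ (labelings p) (proper κ) _)))) ⟩
  ∑[ κ ← allFuns p k ] (content κ * properAscentCount H κ i)
    ∎
  where
  open ≡-Reasoning
  content proper : (Fin p → Fin k) → ℕ
  content κ = ⟦ matches (preimages κ) β ⟧
  proper κ = ⟦ isProper H κ ⟧
  factor : ∀ L κ → ⟦ isLabeling L ∧ isProper H κ ∧ hasContent κ β ∧ (asc H L κ ≡ᵇ i) ⟧ ≡
                   content κ * (proper κ * (⟦ isLabeling L ⟧ * ⟦ ascents H L κ ≡ᵇ i ⟧))
  factor L κ = begin
    ⟦ isLabeling L ∧ isProper H κ ∧ hasContent κ β ∧ (asc H L κ ≡ᵇ i) ⟧
      ≡⟨ trans (⟦∧⟧ (isLabeling L) _) (cong (⟦ isLabeling L ⟧ *_)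
           (trans (⟦∧⟧ (isProper H κ) _) (cong (proper κ *_) (⟦∧⟧ (hasContent κ β) _)))) ⟩
    ⟦ isLabeling L ⟧ * (proper κ * (⟦ hasContent κ β ⟧ * ⟦ asc H L κ ≡ᵇ i ⟧))
      ≡⟨ reorder ⟦ isLabeling L ⟧ (proper κ) ⟦ hasContent κ β ⟧ ⟦ asc H L κ ≡ᵇ i ⟧ ⟩
    ⟦ hasContent κ β ⟧ * (proper κ * (⟦ isLabeling L ⟧ * ⟦ asc H L κ ≡ᵇ i ⟧))
      ≡⟨ cong₂ (λ c a → ⟦ c ⟧ * (proper κ * (⟦ isLabeling L ⟧ * ⟦ a ≡ᵇ i ⟧)))
           (allB-cong λ c → cong (_≡ᵇ lookup β c) (sumMap-allFin λ u → ⟦ κ u == c ⟧)) (asc≡ascents H L κ) ⟩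
    content κ * (proper κ * (⟦ isLabeling L ⟧ * ⟦ ascents H L κ ≡ᵇ i ⟧))
      ∎
    where
    reorder : ∀ a b c d → a * (b * (c * d)) ≡ c * (b * (a * d))
    reorder = solve-∀

module _ {n m k} (G : SimpleGraph n) (G′ : SimpleGraph m) (κ₁ : Fin n → Fin k) (κ₂ : Fin m → Fin k) where
  open Shuffle n m using (left; right; shuffle)

  ascentCount-⊔ : ∀ j → ascentCount (G ⊔ G′) (κ₁ ++ κ₂) j ≡
    ((n + m) C n) * ∑[ i ← upTo (suc j) ] (ascentCount G κ₁ i * ascentCount G′ κ₂ (j ∸ i))
  ascentCount-⊔ j = begin
    ∑[ L ← labelings (n + m) ] (⟦ isLabeling L ⟧ * ⟦ ascents (G ⊔ G′) L (κ₁ ++ κ₂) ≡ᵇ j ⟧)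
      ≡⟨ sumMap-cong (labelings (n + m)) (λ L → cong (λ a → ⟦ isLabeling L ⟧ * ⟦ a ≡ᵇ j ⟧) (split-ascents L)) ⟩
    ∑[ L ← labelings (n + m) ] (⟦ isLabeling L ⟧ * ⟦ ascentsˡ L + ascentsʳ L ≡ᵇ j ⟧)
      ≡⟨ sumMap-cong (labelings (n + m)) (λ L → trans (cong (⟦ isLabeling L ⟧ *_) (indicator-+ (ascentsˡ L) (ascentsʳ L) j))
           (sumMap-*ˡ (upTo (suc j)) ⟦ isLabeling L ⟧ _)) ⟩
    ∑[ L ← labelings (n + m) ] ∑[ i ← upTo (suc j) ] (⟦ isLabeling L ⟧ * (⟦ ascentsˡ L ≡ᵇ i ⟧ * ⟦ ascentsʳ L ≡ᵇ j ∸ i ⟧))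
      ≡⟨ sumMap-comm (labelings (n + m)) (upTo (suc j)) _ ⟩
    ∑[ i ← upTo (suc j) ] ∑[ L ← labelings (n + m) ] (⟦ isLabeling L ⟧ * (⟦ ascentsˡ L ≡ᵇ i ⟧ * ⟦ ascentsʳ L ≡ᵇ j ∸ i ⟧))
      ≡⟨ sumMap-cong (upTo (suc j)) (λ i → shuffle (λ A → ⟦ ascents G A κ₁ ≡ᵇ i ⟧) (λ B → ⟦ ascents G′ B κ₂ ≡ᵇ j ∸ i ⟧)
           (λ {A} {A′} A≗A′ → cong (λ a → ⟦ a ≡ᵇ i ⟧) (ascents-order-invariant G κ₁ A A′ (same-order A≗A′)))
           (λ {B} {B′} B≗B′ → cong (λ a → ⟦ a ≡ᵇ j ∸ i ⟧) (ascents-order-invariant G′ κ₂ B B′ (same-order B≗B′)))) ⟩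
    ∑[ i ← upTo (suc j) ] (((n + m) C n) * (ascentCount G κ₁ i * ascentCount G′ κ₂ (j ∸ i)))
      ≡⟨ sumMap-*ˡ (upTo (suc j)) ((n + m) C n) _ ⟨
    ((n + m) C n) * ∑[ i ← upTo (suc j) ] (ascentCount G κ₁ i * ascentCount G′ κ₂ (j ∸ i))
      ∎
    where
    open ≡-Reasoning
    ascentsˡ ascentsʳ : (Fin (n + m) → Fin (n + m)) → ℕ
    ascentsˡ L = ascents G (standardize (left L)) κ₁
    ascentsʳ L = ascents G′ (standardize (right L)) κ₂
    split-ascents : ∀ L → ascents (G ⊔ G′) L (κ₁ ++ κ₂) ≡ ascentsˡ L + ascentsʳ L
    split-ascents L = trans (ascents-⊔ G G′ L κ₁ κ₂) (sym (cong₂ _+_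
      (ascents-order-invariant G κ₁ (standardize (left L)) (left L) (standardize-<ᶠ (left L)))
      (ascents-order-invariant G′ κ₂ (standardize (right L)) (right L) (standardize-<ᶠ (right L)))))
    same-order : ∀ {p} {f g : Fin p → Fin p} → f ≗ g → ∀ u v → (f u <ᶠ f v) ≡ (g u <ᶠ g v)
    same-order f≗g u v = cong₂ _<ᶠ_ (f≗g u) (f≗g v)

  coloringTerm-⊔ : ∀ (α : Vec ℕ k) j →
    coloringTerm (G ⊔ G′) (κ₁ ++ κ₂) α j ≡ ((n + m) C n) * cauchy (coloringTerm G κ₁) (coloringTerm G′ κ₂) α j
  coloringTerm-⊔ α j = begin
    ⟦ matches (preimages (κ₁ ++ κ₂)) α ⟧ * (⟦ isProper (G ⊔ G′) (κ₁ ++ κ₂) ⟧ * ascentCount (G ⊔ G′) (κ₁ ++ κ₂) j)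
      ≡⟨ cong₂ (λ c p → ⟦ c ⟧ * (⟦ p ⟧ * ascentCount (G ⊔ G′) (κ₁ ++ κ₂) j))
           (allB-cong λ c → cong (_≡ᵇ lookup α c) (preimages-++ κ₁ κ₂ c)) (isProper-⊔ G G′ κ₁ κ₂) ⟩
    ⟦ matches x α ⟧ * (⟦ isProper G κ₁ ∧ isProper G′ κ₂ ⟧ * ascentCount (G ⊔ G′) (κ₁ ++ κ₂) j)
      ≡⟨ cong₂ (λ p a → ⟦ matches x α ⟧ * (p * a)) (⟦∧⟧ (isProper G κ₁) _) (ascentCount-⊔ j) ⟩
    ⟦ matches x α ⟧ * ((p₁ * p₂) * (((n + m) C n) * ∑[ i ← upTo (suc j) ] (ascentCount G κ₁ i * ascentCount G′ κ₂ (j ∸ i))))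
      ≡⟨ cong (⟦ matches x α ⟧ *_) (trans (x*[y*z]≡y*[x*z] (p₁ * p₂) ((n + m) C n) _) (cong (((n + m) C n) *_) distribute-proper)) ⟩
    ⟦ matches x α ⟧ * (((n + m) C n) * ∑[ i ← upTo (suc j) ] (properAscentCount G κ₁ i * properAscentCount G′ κ₂ (j ∸ i)))
      ≡⟨ x*[y*z]≡y*[x*z] ⟦ matches x α ⟧ ((n + m) C n) _ ⟩
    ((n + m) C n) * (⟦ matches x α ⟧ * ∑[ i ← upTo (suc j) ] (properAscentCount G κ₁ i * properAscentCount G′ κ₂ (j ∸ i)))
      ≡⟨ cong (((n + m) C n) *_) (cauchy-monomials α j (preimages κ₁) (preimages κ₂) (properAscentCount G κ₁) (properAscentCount G′ κ₂)) ⟨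
    ((n + m) C n) * cauchy (coloringTerm G κ₁) (coloringTerm G′ κ₂) α j
      ∎
    where
    open ≡-Reasoning
    x : Fin k → ℕ
    x c = preimages κ₁ c + preimages κ₂ c
    p₁ = ⟦ isProper G κ₁ ⟧
    p₂ = ⟦ isProper G′ κ₂ ⟧
    distribute-proper : (p₁ * p₂) * ∑[ i ← upTo (suc j) ] (ascentCount G κ₁ i * ascentCount G′ κ₂ (j ∸ i)) ≡
                        ∑[ i ← upTo (suc j) ] (properAscentCount G κ₁ i * properAscentCount G′ κ₂ (j ∸ i))
    distribute-proper = trans (sumMap-*ˡ (upTo (suc j)) (p₁ * p₂) _) (sumMap-cong (upTo (suc j)) λ i → *-interchange p₁ p₂ _ _)

proposition3p3 : (n m : ℕ) (G : SimpleGraph n) (G' : SimpleGraph m) →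
    (k : ℕ) (α : Vec ℕ k) (j : ℕ) →
    Tχ (G ⊔ G') k α j ≡ (((n + m) C n) ·ˢ (Tχ G ⊛ Tχ G')) k α j
proposition3p3 n m G G′ k α j = begin
  Tχ (G ⊔ G′) k α j
    ≡⟨ Tχ-by-colorings (G ⊔ G′) k α j ⟩
  ∑[ κ ← allFuns (n + m) k ] coloringTerm (G ⊔ G′) κ α j
    ≡⟨ allFuns-++ n m k _ (coloringTerm-ext (G ⊔ G′) α j) ⟩
  ∑[ κ₁ ← allFuns n k ] ∑[ κ₂ ← allFuns m k ] coloringTerm (G ⊔ G′) (κ₁ ++ κ₂) α j
    ≡⟨ sumMap-cong (allFuns n k) (λ κ₁ → sumMap-cong (allFuns m k) λ κ₂ → coloringTerm-⊔ G G′ κ₁ κ₂ α j) ⟩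
  ∑[ κ₁ ← allFuns n k ] ∑[ κ₂ ← allFuns m k ] ((N C n) * cauchy (coloringTerm G κ₁) (coloringTerm G′ κ₂) α j)
    ≡⟨ sumMap₂-*ˡ (allFuns n k) (allFuns m k) (N C n) _ ⟨
  (N C n) * ∑[ κ₁ ← allFuns n k ] ∑[ κ₂ ← allFuns m k ] cauchy (coloringTerm G κ₁) (coloringTerm G′ κ₂) α j
    ≡⟨ cong ((N C n) *_) (cauchy-sumMap (allFuns n k) (allFuns m k) (coloringTerm G) (coloringTerm G′) α j) ⟨
  (N C n) * cauchy (λ β i → ∑[ κ ← allFuns n k ] coloringTerm G κ β i) (λ γ i → ∑[ κ ← allFuns m k ] coloringTerm G′ κ γ i) α j
    ≡⟨ cong ((N C n) *_) (cauchy-cong (Tχ-by-colorings G k) (Tχ-by-colorings G′ k) α j) ⟨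
  (N C n) * cauchy (Tχ G k) (Tχ G′ k) α j
    ∎
  where
  open ≡-Reasoning
  N = n + m
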